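{- Let $U$ be a finite set and let $H^+=\{h_1^+,\dots,h_{d_2}^+\}$ be produced by $\textbf{HashScheme}(U,k)$ as described in the context. For any subset $S$ of $U$ with $|S|=k\ge 2$, with probability at least $1-4/(k^3\ln k)$ there are $k$ pairwise disjoint subsets $H^+_{inv}(q_1),\dots,H^+_{inv}(q_k)$ of $U$ such that $|H^+_{inv}(q_i)\cap S|=1$ for all $i\in\{1,\dots,k\}$.
   Context: For a positive integer $i$ write $[i]^-=\{0,1,\dots,i-1\}$. A family $\mathcal{H}$ of functions $U\to[r]^-$ is $\kappa$-wise independent if for any $\kappa$ distinct $x_1,\dots,x_\kappa\in U$ and any $a_1,\dots,a_\kappa\in[r]^-$, $\Pr_{h}[h(x_1)=a_1\wedge\dots\wedge h(x_\kappa)=a_\kappa]=1/r^\kappa$ for $h$ uniform from $\mathcal{H}$. A family $\mathcal{H}$ of functions $U\to[r]^-$ is universal if for all distinct $x,y\in U$, $\Pr_h[h(x)=h(y)]\le 1/r$ for $h$ uniform from $\mathcal{H}$. $\textbf{HashScheme}(U,k)$: Level 1: pick $f$ uniformly at random from a $\lceil 12\ln k\rceil$-wise independent family of functions $U\to[d_1]^-$, where $d_1=2^d$ and $d$ is the smallest integer with $k/\ln k\le 2^d$. Level 2: pick uniformly at random and independently $d_2=\lceil 8\ln k\rceil$ functions $h_1,\dots,h_{d_2}$ from a universal family of functions $U\to[d_3]^-$, $d_3=\lceil 13\ln k\rceil^2$. Set $h_i^+(x)=f(x)d_2d_3+(i-1)d_3+h_i(x)$, $i=1,\dots,d_2$;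 each maps $U$ to $[d_1d_2d_3]^-$. For $q\in[d_1d_2d_3]^-$, $H^+_{inv}(q)=\{x\in U: h_i^+(x)=q \text{ for some } i\in\{1,\dots,d_2\}\}$. -}

module Defs where

open import Data.Nat using (ℕ; zero; suc; _+_; _*_; _∸_; _^_; _≤_; _<_; _!)

open import Data.Bool using (Bool)
open import Data.Fin using (Fin; toℕ)
open import Data.Fin.Properties using (_≟_)
open import Data.Fin.Subset using (Subset; _∈_)
open import Data.List using (List; length; filterᵇ; allFin)
open import Data.Bool.ListAction using (all)
open import Data.Vec using (Vec; lookup)
open import Data.Product using (Σ; ∃; ∃-syntax; _×_; _,_)
open import Data.Empty using (⊥)
open import Relation.Nullary using (¬_)
open import Relation.Nullary.Decidable using (⌊_⌋)
open import Relation.Binary.PropositionalEquality using (_≡_; _≢_)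
open import Function.Definitions using (Injective)

-- Exponential function, handled exactly via its Taylor partial sums.
-- expNum N a = Σ_{j=0}^{N} a^j * N!/j!, so that
--   expNum N a / N!  =  Σ_{j=0}^{N} a^j / j!   (N-th partial sum of e^a).

expNum : ℕ → ℕ → ℕ
expNum zero    a = 1
expNum (suc N) a = suc N * expNum N a + a ^ suc N

-- m ≤ e^a  (the partial sums increase to e^a, and e^a ∉ ℕ for a ≥ 1,
-- so m ≤ e^a iff some partial sum is ≥ m)
LeExp : ℕ → ℕ → Set
LeExp m a = ∃[ N ] (m * (N !) ≤ expNum N a)

-- e^a ≤ m  (every partial sum is ≤ m)
ExpLe : ℕ → ℕ → Set
ExpLe a m = ∀ N → expNum N a ≤ m * (N !)

-- n = ⌈ c · ln k ⌉  (for k ≥ 1): n is the least natural number with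
-- c · ln k ≤ n, i.e. with k^c ≤ e^n.
IsCeilMulLn : ℕ → ℕ → ℕ → Set
IsCeilMulLn c k n = LeExp (k ^ c) n × (∀ m → m < n → ¬ LeExp (k ^ c) m)

-- d is the smallest integer with k / ln k ≤ 2^d  (k ≥ 2, so ln k > 0;
-- k / ln k ≤ 2^d  ⇔  k ≤ 2^d ln k  ⇔  e^k ≤ k^(2^d)).  Since
-- k / ln k ≥ e > 1 for k ≥ 2, the smallest such integer is ≥ 1,
-- so ranging over ℕ loses nothing.
LogPowCond : ℕ → ℕ → Set
LogPowCond k d = ExpLe k (k ^ (2 ^ d))

IsMinLogPow : ℕ → ℕ → Set
IsMinLogPow k d = LogPowCond k d × (∀ d′ → d′ < d → ¬ LogPowCond k d′)

-- Finite families of functions (multisets, given by an indexing Fin n)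

countᶠ : {n : ℕ} → (Fin n → Bool) → ℕ
countᶠ {n} p = length (filterᵇ p (allFin n))

KWiseIndependent : (κ : ℕ) {u r nF : ℕ} → (Fin nF → Fin u → Fin r) → Set
KWiseIndependent κ {u} {r} {nF} F =
  (xs : Fin κ → Fin u) → Injective _≡_ _≡_ xs → (as : Fin κ → Fin r) →
  countᶠ (λ ι → all (λ i → ⌊ F ι (xs i) ≟ as i ⌋) (allFin κ)) * r ^ κ ≡ nF

Universal : {u r nH : ℕ} → (Fin nH → Fin u → Fin r) → Set
Universal {u} {r} {nH} H =
  (x y : Fin u) → x ≢ y → countᶠ (λ ι → ⌊ H ι x ≟ H ι y ⌋) * r ≤ nH

-- h_i^+(x) = f(x) d2 d3 + (i-1) d3 + h_i(x)   (i : Fin d2 stands for i-1)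
hplus : {u d1 d2 d3 : ℕ} → (Fin u → Fin d1) → (Fin d2 → Fin u → Fin d3) →
        Fin d2 → Fin u → ℕ
hplus {u} {d1} {d2} {d3} f hs i x =
  toℕ (f x) * d2 * d3 + toℕ i * d3 + toℕ (hs i x)

InHinv : {u d1 d2 d3 : ℕ} → (Fin u → Fin d1) → (Fin d2 → Fin u → Fin d3) →
         ℕ → Fin u → Set
InHinv f hs q x = ∃[ i ] hplus f hs i x ≡ q

GoodEvent : {u d1 d2 d3 : ℕ} → (Fin u → Fin d1) → (Fin d2 → Fin u → Fin d3) →
            Subset u → ℕ → Set
GoodEvent {u} {d1} {d2} {d3} f hs S k =
  Σ (Fin k → Fin (d1 * d2 * d3)) λ qs →
    (∀ i j → i ≢ j → ∀ x → InHinv f hs (toℕ (qs i)) x →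
                           InHinv f hs (toℕ (qs j)) x → ⊥)
    × (∀ i → ∃[ x ] (x ∈ S × InHinv f hs (toℕ (qs i)) x
                 × (∀ y → y ∈ S → InHinv f hs (toℕ (qs i)) y → y ≡ x)))

-- a sample outcome: index of f in the first family and the indices of
-- h_1..h_{d2} (independent) in the second family
Sample : ℕ → ℕ → ℕ → Set
Sample nF nH d2 = Fin nF × Vec (Fin nH) d2

GoodSample : {u d1 d3 nF nH d2 : ℕ} →
             (Fin nF → Fin u → Fin d1) → (Fin nH → Fin u → Fin d3) →
             Subset u → ℕ → Sample nF nH d2 → Set
GoodSample F H S k (ι , js) = GoodEvent (F ι) (λ i → H (lookup js i)) S k

{-# OPTIONS --safe #-}
module Submission where

-- A sample (f, h₁, …, h_{d₂}) is good when for every x ∈ S some hᵢ is injective on the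
-- elements of S in x's bucket f⁻¹(f x).  Choosing for x the least such i (which depends
-- only on the bucket) and q = hᵢ⁺(x), the sets H⁺_inv(q) are pairwise disjoint and meet S
-- exactly in x, because f(x) d₂ d₃ + i d₃ + hᵢ(x) determines f(x), i and hᵢ(x).
-- A sample is bad only if (a) some bucket of f receives κ = ⌈12 ln k⌉ elements of S, which
-- by κ-wise independence happens for at most C(k,κ) d₁ / d₁^κ ≤ 2/k⁴ of the f, or (b) all
-- buckets have fewer than κ ≤ c = ⌈13 ln k⌉ elements, but for some x every hᵢ has a
-- collision in x's bucket; by universality each hᵢ collides with probability at most
-- C(c,2)/c² ≤ 1/2, so (b) has probability at most k 2^{-d₂} ≤ 1/k⁴.  Hence at most a
-- fraction 3/k⁴ ≤ 4/(k³ ln k) of the samples is bad.  The logarithms in the parameters are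
-- handled through the partial sums of the exponential series, for which the bounds
-- e^{x+y} ≤ eˣ eʸ and eˣ eʸ ≤ e^{x+y} are proved partial sum by partial sum.

open import Defs
open import Data.Nat using (ℕ; _*_; _∸_; _^_; _≤_)
open import Data.Fin using (Fin)
open import Data.Fin.Subset using (Subset; ∣_∣)
open import Data.List using (List; length)
open import Data.List.Relation.Unary.All using (All)
open import Data.List.Relation.Unary.Unique.Propositional using (Unique)
open import Data.Product using (∃-syntax; _×_)
open import Relation.Binary.PropositionalEquality using (_≡_)

open import Data.Nat using (zero; suc; _+_; _<_; z≤n; s≤s; _!; _%_; _≤ᵇ_; NonZero; >-nonZero)
open import Data.Nat.Properties
open import Data.Nat.Combinatorics renaming (_C_ to infixl 8 _C_)
  using (nCk≡n!/k![n-k]!; k![n∸k]!∣n!; k>n⇒nCk≡0; nC1≡n; nCk+nC[k+1]≡[n+1]C[k+1])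
open import Data.Nat.DivMod using (m/n*n≡m; [m+kn]%n≡m%n; m<n⇒m%n≡m)
open import Data.Nat.Tactic.RingSolver using (solve-∀)
open import Data.Bool using (Bool; true; false; _∧_; _∨_; not; T; T?)
open import Data.Bool.Properties using (T-∧; not-involutive)
open import Data.Bool.ListAction using (any; all; and)
open import Data.Fin using (zero; suc; toℕ; fromℕ<)
open import Data.Fin.Properties using (toℕ-injective; toℕ<n; toℕ-fromℕ<)
  renaming (_≟_ to _≟ᶠ_; suc-injective to suc-injectiveᶠ)
open import Data.Fin.Subset using () renaming (_∈_ to _∈ₛ_)
open import Data.List using ([]; _∷_; _++_; map; filterᵇ; lookup; allFin; cartesianProductWith; cartesianProduct)
open import Data.List.Properties using (length-++; length-map; length-tabulate; map-tabulate)
open import Data.List.Membership.Propositional using (_∈_; find; lose)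
open import Data.List.Membership.Propositional.Properties
  using (∈-map⁺; ∈-map⁻; ∈-++⁺ˡ; ∈-++⁺ʳ; ∈-++⁻; ∈-lookup; ∈-allFin;
         ∈-cartesianProduct⁺; ∈-cartesianProductWith⁻)
open import Data.List.Relation.Unary.Any using (here; there)
open import Data.List.Relation.Unary.Any.Properties using (any⁺; any⁻)
import Data.List.Relation.Unary.All as All
open import Data.List.Relation.Unary.All.Properties using (all⁺; all-filter)
open import Data.List.Relation.Unary.AllPairs using ([]; _∷_)
import Data.List.Relation.Unary.Unique.Propositional.Properties as Unique
open import Data.Vec using (Vec; []; _∷_) renaming (lookup to lookupᵥ)
open import Data.Vec.Properties using (∷-injective)
open import Data.Product using (_,_; proj₁; proj₂)
open import Data.Sum using (_⊎_; inj₁; inj₂)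
open import Data.Empty using (⊥)
open import Data.Unit using (tt)
open import Function using (_∘_; id; Equivalence)
open import Relation.Binary.PropositionalEquality
  using (_≢_; refl; sym; trans; cong; cong₂; subst; subst₂; module ≡-Reasoning)
open import Relation.Nullary using (¬_; yes; no; contradiction)
open import Relation.Nullary.Decidable using (⌊_⌋; fromWitness)
open import Algebra.Properties.CommutativeSemigroup *-commutativeSemigroup
  using (x∙yz≈y∙xz; xy∙z≈xz∙y; xy∙z≈x∙zy; x∙yz≈xz∙y)
open import Algebra.Properties.CommutativeSemigroup +-commutativeSemigroup
  using () renaming (interchange to +-interchange)

-- Finite sums and binomial coefficients

∑< : ℕ → (ℕ → ℕ) → ℕ
∑< zero    f = 0
∑< (suc n) f = ∑< n f + f n

∑<-cong : ∀ n {f g : ℕ → ℕ} → (∀ i → i < n → f i ≡ g i) → ∑< n f ≡ ∑< n g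
∑<-cong zero    f≡g = refl
∑<-cong (suc n) f≡g = cong₂ _+_ (∑<-cong n (λ i i<n → f≡g i (m<n⇒m<1+n i<n))) (f≡g n (n<1+n n))

∑<-mono-≤ : ∀ n {f g : ℕ → ℕ} → (∀ i → i < n → f i ≤ g i) → ∑< n f ≤ ∑< n g
∑<-mono-≤ zero    f≤g = z≤n
∑<-mono-≤ (suc n) f≤g = +-mono-≤ (∑<-mono-≤ n (λ i i<n → f≤g i (m<n⇒m<1+n i<n))) (f≤g n (n<1+n n))

∑<-monoˡ-≤ : ∀ {m n} (f : ℕ → ℕ) → m ≤ n → ∑< m f ≤ ∑< n f
∑<-monoˡ-≤ {m} {zero}  f z≤n = ≤-refl
∑<-monoˡ-≤ {m} {suc n} f m≤1+n with m ≟ suc n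
... | yes refl = ≤-refl
... | no  m≢1+n = ≤-trans (∑<-monoˡ-≤ f (≤-pred (≤∧≢⇒< m≤1+n m≢1+n))) (m≤m+n _ _)

∑<-distrib-+ : ∀ n (f g : ℕ → ℕ) → ∑< n (λ i → f i + g i) ≡ ∑< n f + ∑< n g
∑<-distrib-+ zero    f g = refl
∑<-distrib-+ (suc n) f g =
  trans (cong (_+ (f n + g n)) (∑<-distrib-+ n f g)) (+-interchange (∑< n f) (∑< n g) (f n) (g n))

*-distribˡ-∑< : ∀ n c (f : ℕ → ℕ) → c * ∑< n f ≡ ∑< n (λ i → c * f i)
*-distribˡ-∑< zero    c f = *-zeroʳ c
*-distribˡ-∑< (suc n) c f = trans (*-distribˡ-+ c (∑< n f) (f n)) (cong (_+ c * f n) (*-distribˡ-∑< n c f))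

*-distribʳ-∑< : ∀ n c (f : ℕ → ℕ) → ∑< n f * c ≡ ∑< n (λ i → f i * c)
*-distribʳ-∑< n c f = trans (*-comm (∑< n f) c)
  (trans (*-distribˡ-∑< n c f) (∑<-cong n (λ i _ → *-comm c (f i))))

∑<-suc : ∀ n (f : ℕ → ℕ) → ∑< (suc n) f ≡ f 0 + ∑< n (λ i → f (suc i))
∑<-suc zero    f = sym (+-identityʳ (f 0))
∑<-suc (suc n) f = trans (cong (_+ f (suc n)) (∑<-suc n f)) (+-assoc (f 0) _ _)

nCk*[k!*[n∸k]!]≡n! : ∀ {n k} → k ≤ n → n C k * (k ! * (n ∸ k) !) ≡ n !
nCk*[k!*[n∸k]!]≡n! {n} {k} k≤n = trans (cong (_* (k ! * (n ∸ k) !)) (nCk≡n!/k![n-k]! k≤n))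
  (m/n*n≡m {{k !* (n ∸ k) !≢0}} (k![n∸k]!∣n! k≤n))

[1+n]C[1+k]*[1+k]≡[1+n]*nCk : ∀ n k → suc n C suc k * suc k ≡ suc n * n C k
[1+n]C[1+k]*[1+k]≡[1+n]*nCk n k with k ≤? n
... | no k≰n = trans (cong (_* suc k) (k>n⇒nCk≡0 (s≤s (≰⇒> k≰n))))
                     (sym (trans (cong (suc n *_) (k>n⇒nCk≡0 (≰⇒> k≰n))) (*-zeroʳ (suc n))))
... | yes k≤n = *-cancelʳ-≡ _ _ (k ! * (n ∸ k) !) {{k !* (n ∸ k) !≢0}} (begin
  suc n C suc k * suc k * (k ! * (n ∸ k) !)   ≡⟨ *-assoc (suc n C suc k) (suc k) _ ⟩
  suc n C suc k * (suc k * (k ! * (n ∸ k) !)) ≡⟨ cong (suc n C suc k *_) (*-assoc (suc k) (k !) _) ⟨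
  suc n C suc k * (suc k ! * (n ∸ k) !)       ≡⟨ nCk*[k!*[n∸k]!]≡n! (s≤s k≤n) ⟩
  suc n * n !                                 ≡⟨ cong (suc n *_) (nCk*[k!*[n∸k]!]≡n! k≤n) ⟨
  suc n * (n C k * (k ! * (n ∸ k) !))         ≡⟨ *-assoc (suc n) (n C k) _ ⟨
  suc n * n C k * (k ! * (n ∸ k) !)           ∎)
  where open ≡-Reasoning

[1+n]Ck*[1+n∸k]≡[1+n]*nCk : ∀ {n k} → k ≤ n → suc n C k * suc (n ∸ k) ≡ suc n * n C k
[1+n]Ck*[1+n∸k]≡[1+n]*nCk {n} {k} k≤n = *-cancelʳ-≡ _ _ (k ! * (n ∸ k) !) {{k !* (n ∸ k) !≢0}} (begin
  suc n C k * suc (n ∸ k) * (k ! * (n ∸ k) !)   ≡⟨ *-assoc (suc n C k) (suc (n ∸ k)) _ ⟩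
  suc n C k * (suc (n ∸ k) * (k ! * (n ∸ k) !)) ≡⟨ cong (suc n C k *_) (x∙yz≈y∙xz (suc (n ∸ k)) (k !) _) ⟩
  suc n C k * (k ! * suc (n ∸ k) !)             ≡⟨ cong (λ m → suc n C k * (k ! * m !)) (+-∸-assoc 1 k≤n) ⟨
  suc n C k * (k ! * (suc n ∸ k) !)             ≡⟨ nCk*[k!*[n∸k]!]≡n! (m≤n⇒m≤1+n k≤n) ⟩
  suc n * n !                                   ≡⟨ cong (suc n *_) (nCk*[k!*[n∸k]!]≡n! k≤n) ⟨
  suc n * (n C k * (k ! * (n ∸ k) !))           ≡⟨ *-assoc (suc n) (n C k) _ ⟨
  suc n * n C k * (k ! * (n ∸ k) !)             ∎)
  where open ≡-Reasoning

nCk*k!≤n^k : ∀ n k → n C k * k ! ≤ n ^ k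
nCk*k!≤n^k n       zero    = ≤-refl
nCk*k!≤n^k zero    (suc k) = z≤n
nCk*k!≤n^k (suc n) (suc k) = begin
  suc n C suc k * (suc k * k !) ≡⟨ *-assoc (suc n C suc k) (suc k) (k !) ⟨
  suc n C suc k * suc k * k !   ≡⟨ cong (_* k !) ([1+n]C[1+k]*[1+k]≡[1+n]*nCk n k) ⟩
  suc n * n C k * k !           ≡⟨ *-assoc (suc n) (n C k) (k !) ⟩
  suc n * (n C k * k !)         ≤⟨ *-monoʳ-≤ (suc n) (≤-trans (nCk*k!≤n^k n k) (^-monoˡ-≤ k (n≤1+n n))) ⟩
  suc n * suc n ^ k             ∎
  where open ≤-Reasoning

binomial-theorem : ∀ n x y → (x + y) ^ n ≡ ∑< (suc n) (λ i → n C i * x ^ i * y ^ (n ∸ i))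
binomial-theorem zero    x y = refl
binomial-theorem (suc n) x y = begin
  (x + y) * (x + y) ^ n                        ≡⟨ cong ((x + y) *_) (binomial-theorem n x y) ⟩
  (x + y) * ∑< (suc n) t                       ≡⟨ *-distribʳ-+ (∑< (suc n) t) x y ⟩
  x * ∑< (suc n) t + y * ∑< (suc n) t          ≡⟨ cong₂ _+_ x*∑t y*∑t ⟩
  ∑< (suc n) f + ∑< (suc n) g                  ≡⟨ cong (∑< (suc n) f +_) ∑g ⟩
  ∑< (suc n) f + (g 0 + ∑< (suc n) (g ∘ suc))  ≡⟨ x∙yz≈y∙xz′ (∑< (suc n) f) (g 0) _ ⟩
  g 0 + (∑< (suc n) f + ∑< (suc n) (g ∘ suc))  ≡⟨ cong (g 0 +_) (∑<-distrib-+ (suc n) f (g ∘ suc)) ⟨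
  g 0 + ∑< (suc n) (λ i → f i + g (suc i))     ≡⟨ cong (g 0 +_) (∑<-cong (suc n) (λ i _ → pascal i)) ⟩
  h 0 + ∑< (suc n) (h ∘ suc)                   ≡⟨ ∑<-suc (suc n) h ⟨
  ∑< (suc (suc n)) h                           ∎
  where
  open ≡-Reasoning
  -- g 0 and h 0 agree definitionally, since m C 0 reduces to 1.
  t f g h : ℕ → ℕ
  t i = n C i * x ^ i * y ^ (n ∸ i)
  f i = n C i * x ^ suc i * y ^ (n ∸ i)
  g i = n C i * x ^ i * y ^ (suc n ∸ i)
  h i = suc n C i * x ^ i * y ^ (suc n ∸ i)
  x∙yz≈y∙xz′ : ∀ a b c → a + (b + c) ≡ b + (a + c)
  x∙yz≈y∙xz′ = solve-∀
  x*∑t : x * ∑< (suc n) t ≡ ∑< (suc n) f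
  x*∑t = trans (*-distribˡ-∑< (suc n) x t) (∑<-cong (suc n) (λ i _ → lemma x (n C i) (x ^ i) (y ^ (n ∸ i))))
    where
    lemma : ∀ x c a b → x * (c * a * b) ≡ c * (x * a) * b
    lemma = solve-∀
  y*∑t : y * ∑< (suc n) t ≡ ∑< (suc n) g
  y*∑t = trans (*-distribˡ-∑< (suc n) y t) (∑<-cong (suc n) λ i i<1+n →
    trans (lemma y (n C i) (x ^ i) (y ^ (n ∸ i))) (cong (λ e → n C i * x ^ i * y ^ e) (sym (+-∸-assoc 1 (≤-pred i<1+n)))))
    where
    lemma : ∀ y c a b → y * (c * a * b) ≡ c * a * (y * b)
    lemma = solve-∀
  ∑g : ∑< (suc n) g ≡ g 0 + ∑< (suc n) (g ∘ suc)
  ∑g = trans (sym (trans (cong (∑< (suc n) g +_) g[1+n]≡0) (+-identityʳ _))) (∑<-suc (suc n) g)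
    where
    g[1+n]≡0 : g (suc n) ≡ 0
    g[1+n]≡0 rewrite k>n⇒nCk≡0 (n<1+n n) = refl
  pascal : ∀ i → f i + g (suc i) ≡ h (suc i)
  pascal i = begin
    n C i * x ^ suc i * y ^ (n ∸ i) + n C suc i * x ^ suc i * y ^ (n ∸ i)
      ≡⟨ *-distribʳ-+ (y ^ (n ∸ i)) (n C i * x ^ suc i) _ ⟨
    (n C i * x ^ suc i + n C suc i * x ^ suc i) * y ^ (n ∸ i)
      ≡⟨ cong (_* y ^ (n ∸ i)) (*-distribʳ-+ (x ^ suc i) (n C i) (n C suc i)) ⟨
    (n C i + n C suc i) * x ^ suc i * y ^ (n ∸ i)
      ≡⟨ cong (λ c → c * x ^ suc i * y ^ (n ∸ i)) (nCk+nC[k+1]≡[n+1]C[k+1] n i) ⟩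
    suc n C suc i * x ^ suc i * y ^ (n ∸ i) ∎

-- Partial sums of the exponential series

expNum-0 : ∀ N → expNum N 0 ≡ N !
expNum-0 zero    = refl
expNum-0 (suc N) = trans (+-identityʳ _) (cong (suc N *_) (expNum-0 N))

-- Divided by N!, this is the Cauchy product e_N(x + y) = ∑_{i ≤ N} (xⁱ / i!) e_{N-i}(y)
-- of the partial sums e_N(x) = expNum N x / N!.
expNum-+ : ∀ N x y → expNum N (x + y) ≡ ∑< (suc N) (λ i → N C i * x ^ i * expNum (N ∸ i) y)
expNum-+ zero    x y = refl
expNum-+ (suc N) x y = begin
  suc N * expNum N (x + y) + (x + y) ^ suc N
    ≡⟨ cong₂ (λ a b → suc N * a + b) (expNum-+ N x y) (binomial-theorem (suc N) x y) ⟩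
  suc N * ∑< (suc N) c + (∑< (suc N) b + b (suc N))
    ≡⟨ +-assoc (suc N * ∑< (suc N) c) _ _ ⟨
  suc N * ∑< (suc N) c + ∑< (suc N) b + b (suc N)
    ≡⟨ cong (λ s → s + ∑< (suc N) b + b (suc N)) (*-distribˡ-∑< (suc N) (suc N) c) ⟩
  ∑< (suc N) (λ i → suc N * c i) + ∑< (suc N) b + b (suc N)
    ≡⟨ cong (_+ b (suc N)) (∑<-distrib-+ (suc N) (λ i → suc N * c i) b) ⟨
  ∑< (suc N) (λ i → suc N * c i + b i) + b (suc N)
    ≡⟨ cong₂ _+_ (∑<-cong (suc N) (λ i i<1+N → d≡ i (≤-pred i<1+N))) d[1+N]≡b[1+N] ⟨
  ∑< (suc N) d + d (suc N) ∎
  where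
  open ≡-Reasoning
  c b d : ℕ → ℕ
  c i = N C i * x ^ i * expNum (N ∸ i) y
  b i = suc N C i * x ^ i * y ^ (suc N ∸ i)
  d i = suc N C i * x ^ i * expNum (suc N ∸ i) y
  d[1+N]≡b[1+N] : d (suc N) ≡ b (suc N)
  d[1+N]≡b[1+N] rewrite n∸n≡0 N = refl
  d≡ : ∀ i → i ≤ N → d i ≡ suc N * c i + b i
  d≡ i i≤N = begin
    C′ * xⁱ * expNum (suc N ∸ i) y                    ≡⟨ cong (λ e → C′ * xⁱ * expNum e y) [1+N]∸i≡1+m ⟩
    C′ * xⁱ * (suc m * E + y ^ suc m)                 ≡⟨ lemma C′ xⁱ (suc m) E (y ^ suc m) ⟩
    C′ * suc m * (xⁱ * E) + C′ * xⁱ * y ^ suc m       ≡⟨ cong₂ (λ a e → a * (xⁱ * E) + C′ * xⁱ * y ^ e)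
                                                           ([1+n]Ck*[1+n∸k]≡[1+n]*nCk i≤N) (sym [1+N]∸i≡1+m) ⟩
    suc N * N C i * (xⁱ * E) + C′ * xⁱ * y ^ (suc N ∸ i) ≡⟨ cong (_+ b i) (lemma′ (suc N) (N C i) xⁱ E) ⟩
    suc N * c i + b i                                 ∎
    where
    m C′ xⁱ E : ℕ
    m = N ∸ i
    C′ = suc N C i
    xⁱ = x ^ i
    E = expNum m y
    [1+N]∸i≡1+m : suc N ∸ i ≡ suc m
    [1+N]∸i≡1+m = +-∸-assoc 1 i≤N
    lemma : ∀ c a s e w → c * a * (s * e + w) ≡ c * s * (a * e) + c * a * w
    lemma = solve-∀
    lemma′ : ∀ a b c e → a * b * (c * e) ≡ a * (b * c * e)
    lemma′ = solve-∀

expNum≡∑ : ∀ N x → expNum N x ≡ ∑< (suc N) (λ i → N C i * x ^ i * (N ∸ i) !)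
expNum≡∑ N x = begin
  expNum N x                                          ≡⟨ cong (expNum N) (+-identityʳ x) ⟨
  expNum N (x + 0)                                    ≡⟨ expNum-+ N x 0 ⟩
  ∑< (suc N) (λ i → N C i * x ^ i * expNum (N ∸ i) 0) ≡⟨ ∑<-cong (suc N) (λ i _ →
                                                           cong (N C i * x ^ i *_) (expNum-0 (N ∸ i))) ⟩
  ∑< (suc N) (λ i → N C i * x ^ i * (N ∸ i) !)        ∎
  where open ≡-Reasoning

expNum-*-!-mono : ∀ j t y → expNum j y * (j + t) ! ≤ expNum (j + t) y * j !
expNum-*-!-mono j zero    y = subst (λ n → expNum j y * n ! ≤ expNum n y * j !) (sym (+-identityʳ j)) ≤-refl
expNum-*-!-mono j (suc t) y = begin
  expNum j y * (j + suc t) !                ≡⟨ cong (λ n → expNum j y * n !) (+-suc j t) ⟩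
  expNum j y * (suc (j + t) * (j + t) !)    ≡⟨ x∙yz≈y∙xz (expNum j y) (suc (j + t)) _ ⟩
  suc (j + t) * (expNum j y * (j + t) !)    ≤⟨ *-monoʳ-≤ (suc (j + t)) (expNum-*-!-mono j t y) ⟩
  suc (j + t) * (expNum (j + t) y * j !)    ≡⟨ *-assoc (suc (j + t)) (expNum (j + t) y) (j !) ⟨
  suc (j + t) * expNum (j + t) y * j !      ≤⟨ *-monoˡ-≤ (j !) (m≤m+n (suc (j + t) * expNum (j + t) y) (y ^ suc (j + t))) ⟩
  expNum (suc (j + t)) y * j !              ≡⟨ cong (λ n → expNum n y * j !) (+-suc j t) ⟨
  expNum (j + suc t) y * j !                ∎
  where open ≤-Reasoning

expNum-+-≤ : ∀ N x y → expNum N (x + y) * N ! ≤ expNum N x * expNum N y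
expNum-+-≤ N x y = begin
  expNum N (x + y) * N !                                       ≡⟨ cong (_* N !) (expNum-+ N x y) ⟩
  ∑< (suc N) c * N !                                           ≡⟨ *-distribʳ-∑< (suc N) (N !) c ⟩
  ∑< (suc N) (λ i → c i * N !)                                 ≤⟨ ∑<-mono-≤ (suc N) (λ i i<1+N → term i (≤-pred i<1+N)) ⟩
  ∑< (suc N) (λ i → N C i * x ^ i * (N ∸ i) ! * expNum N y)   ≡⟨ *-distribʳ-∑< (suc N) (expNum N y) _ ⟨
  ∑< (suc N) (λ i → N C i * x ^ i * (N ∸ i) !) * expNum N y   ≡⟨ cong (_* expNum N y) (expNum≡∑ N x) ⟨
  expNum N x * expNum N y                                      ∎
  where
  open ≤-Reasoning
  c : ℕ → ℕ
  c i = N C i * x ^ i * expNum (N ∸ i) y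
  term : ∀ i → i ≤ N → c i * N ! ≤ N C i * x ^ i * (N ∸ i) ! * expNum N y
  term i i≤N = begin
    N C i * x ^ i * expNum (N ∸ i) y * N !   ≡⟨ *-assoc (N C i * x ^ i) _ _ ⟩
    N C i * x ^ i * (expNum (N ∸ i) y * N !) ≤⟨ *-monoʳ-≤ (N C i * x ^ i) mono ⟩
    N C i * x ^ i * ((N ∸ i) ! * expNum N y) ≡⟨ *-assoc (N C i * x ^ i) _ _ ⟨
    N C i * x ^ i * (N ∸ i) ! * expNum N y   ∎
    where
    mono : expNum (N ∸ i) y * N ! ≤ (N ∸ i) ! * expNum N y
    mono = subst (λ n → expNum (N ∸ i) y * n ! ≤ (N ∸ i) ! * expNum n y) (m∸n+n≡m i≤N)
             (≤-trans (expNum-*-!-mono (N ∸ i) i y) (≤-reflexive (*-comm (expNum (N ∸ i + i) y) ((N ∸ i) !))))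

expNum-*-≤ : ∀ i j x y → expNum i x * expNum j y * (i + j) ! ≤ expNum (i + j) (x + y) * (i ! * j !)
expNum-*-≤ i j x y = begin
  expNum i x * expNum j y * (i + j) !                 ≡⟨ cong (λ s → s * expNum j y * (i + j) !) (expNum≡∑ i x) ⟩
  ∑< (suc i) f * expNum j y * (i + j) !               ≡⟨ cong (_* (i + j) !) (*-distribʳ-∑< (suc i) (expNum j y) f) ⟩
  ∑< (suc i) (λ a → f a * expNum j y) * (i + j) !     ≡⟨ *-distribʳ-∑< (suc i) ((i + j) !) _ ⟩
  ∑< (suc i) (λ a → f a * expNum j y * (i + j) !)     ≤⟨ ∑<-mono-≤ (suc i) (λ a a<1+i → term a (≤-pred a<1+i)) ⟩
  ∑< (suc i) (λ a → g a * (i ! * j !))                ≤⟨ ∑<-monoˡ-≤ _ (s≤s (m≤m+n i j)) ⟩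
  ∑< (suc (i + j)) (λ a → g a * (i ! * j !))          ≡⟨ *-distribʳ-∑< (suc (i + j)) (i ! * j !) g ⟨
  ∑< (suc (i + j)) g * (i ! * j !)                    ≡⟨ cong (_* (i ! * j !)) (expNum-+ (i + j) x y) ⟨
  expNum (i + j) (x + y) * (i ! * j !)                ∎
  where
  open ≤-Reasoning
  f g : ℕ → ℕ
  f a = i C a * x ^ a * (i ∸ a) !
  g a = (i + j) C a * x ^ a * expNum (i + j ∸ a) y
  term : ∀ a → a ≤ i → f a * expNum j y * (i + j) ! ≤ g a * (i ! * j !)
  term a a≤i = *-cancelʳ-≤ _ _ (a ! * (i + j ∸ a) !) {{a !* (i + j ∸ a) !≢0}} (begin
    i C a * X * (i ∸ a) ! * Tj * K * (a ! * (i + j ∸ a) !)    ≡⟨ lemma (i C a) X ((i ∸ a) !) Tj K (a !) _ ⟩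
    i C a * (a ! * (i ∸ a) !) * X * (Tj * (i + j ∸ a) !) * K  ≡⟨ cong (λ c → c * X * (Tj * (i + j ∸ a) !) * K) (nCk*[k!*[n∸k]!]≡n! a≤i) ⟩
    i ! * X * (Tj * (i + j ∸ a) !) * K                        ≤⟨ *-monoˡ-≤ K (*-monoʳ-≤ (i ! * X) mono) ⟩
    i ! * X * (T′ * j !) * K                                  ≡⟨ cong (i ! * X * (T′ * j !) *_) (nCk*[k!*[n∸k]!]≡n! a≤i+j) ⟨
    i ! * X * (T′ * j !) * ((i + j) C a * (a ! * (i + j ∸ a) !)) ≡⟨ lemma′ (i !) X T′ (j !) ((i + j) C a) (a !) _ ⟩
    (i + j) C a * X * T′ * (i ! * j !) * (a ! * (i + j ∸ a) !) ∎)
    where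
    X Tj T′ K : ℕ
    X = x ^ a
    Tj = expNum j y
    T′ = expNum (i + j ∸ a) y
    K = (i + j) !
    a≤i+j : a ≤ i + j
    a≤i+j = ≤-trans a≤i (m≤m+n i j)
    j+[i∸a]≡i+j∸a : j + (i ∸ a) ≡ i + j ∸ a
    j+[i∸a]≡i+j∸a = trans (sym (+-∸-assoc j a≤i)) (cong (_∸ a) (+-comm j i))
    mono : Tj * (i + j ∸ a) ! ≤ T′ * j !
    mono = subst (λ n → Tj * n ! ≤ expNum n y * j !) j+[i∸a]≡i+j∸a (expNum-*-!-mono j (i ∸ a) y)
    lemma : ∀ c x f t k a g → c * x * f * t * k * (a * g) ≡ c * (a * f) * x * (t * g) * k
    lemma = solve-∀
    lemma′ : ∀ i x t j c a g → i * x * (t * j) * (c * (a * g)) ≡ c * x * t * (i * j) * (a * g)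
    lemma′ = solve-∀

expNum-monoʳ-≤ : ∀ N {x y} → x ≤ y → expNum N x ≤ expNum N y
expNum-monoʳ-≤ zero    x≤y = ≤-refl
expNum-monoʳ-≤ (suc N) x≤y = +-mono-≤ (*-monoʳ-≤ (suc N) (expNum-monoʳ-≤ N x≤y)) (^-monoˡ-≤ (suc N) x≤y)

expNum-monoʳ-< : ∀ N {x y} → x < y → expNum (suc N) x < expNum (suc N) y
expNum-monoʳ-< N x<y = +-mono-≤-< (*-monoʳ-≤ (suc N) (expNum-monoʳ-≤ N (<⇒≤ x<y))) (^-monoˡ-< (suc N) x<y)

^≤expNum : ∀ N a → a ^ N ≤ expNum N a
^≤expNum zero    a = ≤-refl
^≤expNum (suc N) a = m≤n+m _ _

expNum-1 : ∀ N → expNum N 1 + 1 ≤ 3 * N !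
expNum-1 zero          = s≤s (s≤s z≤n)
expNum-1 (suc zero)    = ≤-refl
expNum-1 (suc (suc N)) = begin
  suc (suc N) * expNum (suc N) 1 + 1 ^ suc (suc N) + 1 ≡⟨ cong (λ z → suc (suc N) * expNum (suc N) 1 + z + 1) (^-zeroˡ (suc (suc N))) ⟩
  suc (suc N) * expNum (suc N) 1 + 1 + 1               ≤⟨ m≤m+n _ N ⟩
  suc (suc N) * expNum (suc N) 1 + 1 + 1 + N           ≡⟨ lemma N (expNum (suc N) 1) ⟩
  suc (suc N) * (expNum (suc N) 1 + 1)                 ≤⟨ *-monoʳ-≤ (suc (suc N)) (expNum-1 (suc N)) ⟩
  suc (suc N) * (3 * suc N !)                          ≡⟨ x∙yz≈y∙xz (suc (suc N)) 3 (suc N !) ⟩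
  3 * suc (suc N) !                                    ∎
  where
  open ≤-Reasoning
  lemma : ∀ n e → suc (suc n) * e + 1 + 1 + n ≡ suc (suc n) * (e + 1)
  lemma = solve-∀

expNum≤3^*! : ∀ N a → expNum N a ≤ 3 ^ a * N !
expNum≤3^*! N zero    = ≤-reflexive (trans (expNum-0 N) (sym (+-identityʳ (N !))))
expNum≤3^*! N (suc a) = *-cancelʳ-≤ _ _ (N !) {{N !≢0}} (begin
  expNum N (suc a) * N !        ≡⟨ cong (λ z → expNum N z * N !) (+-comm 1 a) ⟩
  expNum N (a + 1) * N !        ≤⟨ expNum-+-≤ N a 1 ⟩
  expNum N a * expNum N 1       ≤⟨ *-mono-≤ (expNum≤3^*! N a) (≤-trans (m≤m+n _ 1) (expNum-1 N)) ⟩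
  3 ^ a * N ! * (3 * N !)       ≡⟨ lemma (3 ^ a) (N !) ⟩
  3 ^ suc a * N ! * N !         ∎)
  where
  open ≤-Reasoning
  lemma : ∀ x f → x * f * (3 * f) ≡ 3 * x * f * f
  lemma = solve-∀

LeExp-monoˡ : ∀ {m m′ a} → m′ ≤ m → LeExp m a → LeExp m′ a
LeExp-monoˡ m′≤m (N , m*N!≤e) = N , ≤-trans (*-monoˡ-≤ (N !) m′≤m) m*N!≤e

LeExp-monoʳ : ∀ {m a b} → a ≤ b → LeExp m a → LeExp m b
LeExp-monoʳ a≤b (N , m*N!≤e) = N , ≤-trans m*N!≤e (expNum-monoʳ-≤ N a≤b)

LeExp⇒≤3^ : ∀ {m a} → LeExp m a → m ≤ 3 ^ a
LeExp⇒≤3^ {m} {a} (N , m*N!≤e) = *-cancelʳ-≤ _ _ (N !) {{N !≢0}} (≤-trans m*N!≤e (expNum≤3^*! N a))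

LeExp∧ExpLe⇒≤ : ∀ {m a b} → 2 ≤ m → LeExp m b → ExpLe a m → a ≤ b
LeExp∧ExpLe⇒≤ {m} 2≤m (zero , m*1≤1) _ =
  contradiction (≤-trans m*1≤1 (s≤s z≤n)) (<⇒≱ (≤-trans 2≤m (≤-reflexive (sym (*-identityʳ m)))))
LeExp∧ExpLe⇒≤ {m} {a} {b} 2≤m (suc N , m≤eᵇ) eᵃ≤m with b <? a
... | no  b≮a = ≮⇒≥ b≮a
... | yes b<a = contradiction (≤-trans (eᵃ≤m (suc N)) m≤eᵇ) (<⇒≱ (expNum-monoʳ-< N b<a))

ExpLe-^ : ∀ {a m} → ExpLe a m → ∀ n → ExpLe (n * a) (m ^ n)
ExpLe-^ eᵃ≤m zero    N = ≤-reflexive (trans (expNum-0 N) (sym (+-identityʳ (N !))))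
ExpLe-^ {a} {m} eᵃ≤m (suc n) N = *-cancelʳ-≤ _ _ (N !) {{N !≢0}} (begin
  expNum N (a + n * a) * N !       ≤⟨ expNum-+-≤ N a (n * a) ⟩
  expNum N a * expNum N (n * a)    ≤⟨ *-mono-≤ (eᵃ≤m N) (ExpLe-^ eᵃ≤m n N) ⟩
  m * N ! * (m ^ n * N !)          ≡⟨ lemma m (N !) (m ^ n) ⟩
  m * m ^ n * N ! * N !            ∎)
  where
  open ≤-Reasoning
  lemma : ∀ m f p → m * f * (p * f) ≡ m * p * f * f
  lemma = solve-∀

LeExp-^ : ∀ {m a} → LeExp m a → ∀ n → LeExp (m ^ n) (n * a)
LeExp-^ m≤eᵃ zero = 0 , ≤-refl
LeExp-^ {m} {a} (N , m*N!≤e) (suc n) with LeExp-^ (N , m*N!≤e) n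
... | M , mⁿ*M!≤e = N + M , *-cancelʳ-≤ _ _ (N ! * M !) {{N !* M !≢0}} (begin
  m * m ^ n * (N + M) ! * (N ! * M !)       ≡⟨ lemma m (m ^ n) ((N + M) !) (N !) (M !) ⟩
  m * N ! * (m ^ n * M !) * (N + M) !       ≤⟨ *-monoˡ-≤ ((N + M) !) (*-mono-≤ m*N!≤e mⁿ*M!≤e) ⟩
  expNum N a * expNum M (n * a) * (N + M) ! ≤⟨ expNum-*-≤ N M a (n * a) ⟩
  expNum (N + M) (a + n * a) * (N ! * M !)  ∎)
  where
  open ≤-Reasoning
  lemma : ∀ m p k f g → m * p * k * (f * g) ≡ m * f * (p * g) * k
  lemma = solve-∀

n<2^n : ∀ n → n < 2 ^ n
n<2^n zero    = s≤s z≤n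
n<2^n (suc n) = begin-strict
  suc n           <⟨ s≤s (n<2^n n) ⟩
  suc (2 ^ n)     ≡⟨ +-comm 1 (2 ^ n) ⟩
  2 ^ n + 1       ≤⟨ +-monoʳ-≤ (2 ^ n) (m^n>0 2 n) ⟩
  2 ^ n + 2 ^ n   ≡⟨ cong (2 ^ n +_) (+-identityʳ (2 ^ n)) ⟨
  2 ^ suc n       ∎
  where open ≤-Reasoning

LeExp-2^ : ∀ n → LeExp (2 ^ n) n
LeExp-2^ n = subst (LeExp (2 ^ n)) (*-identityʳ n) (LeExp-^ (2 , s≤s (s≤s (s≤s (s≤s z≤n)))) n)

LeExp-^-* : ∀ m n → LeExp (m ^ n) (n * m)
LeExp-^-* m n = LeExp-^ (LeExp-monoˡ (<⇒≤ (n<2^n m)) (LeExp-2^ m)) n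

-- The parameters of HashScheme

^-cancelʳ-≤ : ∀ n {a b} → a ^ suc n ≤ b ^ suc n → a ≤ b
^-cancelʳ-≤ n {a} {b} aⁿ≤bⁿ with b <? a
... | no  b≮a = ≮⇒≥ b≮a
... | yes b<a = contradiction aⁿ≤bⁿ (<⇒≱ (^-monoˡ-< (suc n) b<a))

IsCeilMulLn-mono : ∀ {c c′ k n n′} → 1 ≤ k → c ≤ c′ → IsCeilMulLn c k n → IsCeilMulLn c′ k n′ → n ≤ n′
IsCeilMulLn-mono {k = k} {n} {n′} 1≤k c≤c′ (_ , least) (kᶜ′≤eⁿ′ , _) with n′ <? n
... | no  n′≮n = ≮⇒≥ n′≮n
... | yes n′<n = contradiction (LeExp-monoˡ (^-monoʳ-≤ k {{>-nonZero 1≤k}} c≤c′) kᶜ′≤eⁿ′) (least n′ n′<n)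

IsCeilMulLn⇒NonZero : ∀ {c k n} → 2 ≤ k → IsCeilMulLn (suc c) k n → NonZero n
IsCeilMulLn⇒NonZero {c} {k} {zero} 2≤k (kᶜ≤e⁰ , _) =
  contradiction (LeExp⇒≤3^ kᶜ≤e⁰)
    (<⇒≱ (≤-trans 2≤k (m≤m*n k (k ^ c) {{m^n≢0 k c {{>-nonZero (≤-trans (s≤s z≤n) 2≤k)}}}})))
IsCeilMulLn⇒NonZero {n = suc n} _ _ = _

^-distribʳ-* : ∀ a b n → (a * b) ^ n ≡ a ^ n * b ^ n
^-distribʳ-* a b zero    = refl
^-distribʳ-* a b (suc n) = trans (cong (a * b *_) (^-distribʳ-* a b n)) (*-interchange′ a b (a ^ n) (b ^ n))
  where
  *-interchange′ : ∀ a b c d → a * b * (c * d) ≡ a * c * (b * d)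
  *-interchange′ = solve-∀

LeExp⇒^5≤2^ : ∀ {k n} → LeExp (k ^ 8) n → k ^ 5 ≤ 2 ^ n
LeExp⇒^5≤2^ {k} {n} k⁸≤eⁿ = ^-cancelʳ-≤ 7 (begin
  (k ^ 5) ^ 8  ≡⟨ ^-*-assoc k 5 8 ⟩
  k ^ 40       ≡⟨ ^-*-assoc k 8 5 ⟨
  (k ^ 8) ^ 5  ≤⟨ ^-monoˡ-≤ 5 (LeExp⇒≤3^ {k ^ 8} k⁸≤eⁿ) ⟩
  (3 ^ n) ^ 5  ≡⟨ trans (^-*-assoc 3 n 5) (trans (cong (3 ^_) (*-comm n 5)) (sym (^-*-assoc 3 5 n))) ⟩
  243 ^ n      ≤⟨ ^-monoˡ-≤ n (m≤m+n 243 13) ⟩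
  256 ^ n      ≡⟨ trans (^-*-assoc 2 8 n) (trans (cong (2 ^_) (*-comm 8 n)) (sym (^-*-assoc 2 n 8))) ⟩
  (2 ^ n) ^ 8  ∎)
  where open ≤-Reasoning

IsMinLogPow⇒2^d≤4k : ∀ {k d} → 2 ≤ k → IsMinLogPow k d → 2 ^ d ≤ 4 * k
IsMinLogPow⇒2^d≤4k {k} {zero}   2≤k _ = ≤-trans (≤-trans (s≤s z≤n) 2≤k) (m≤n*m k 4)
IsMinLogPow⇒2^d≤4k {k} {suc d} 2≤k (_ , least) with 2 * k ≤? 2 ^ d
... | yes 2k≤2ᵈ = contradiction eᵏ≤k^2ᵈ (least d (n<1+n d))
  where
  eᵏ≤k^2ᵈ : ExpLe k (k ^ (2 ^ d))
  eᵏ≤k^2ᵈ N = ≤-trans (expNum≤3^*! N k) (*-monoˡ-≤ (N !) (begin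
    3 ^ k         ≤⟨ ^-monoˡ-≤ k (≤-trans (m≤m+n 3 1) (*-mono-≤ 2≤k 2≤k)) ⟩
    (k * k) ^ k   ≡⟨ cong (λ x → (k * x) ^ k) (*-identityʳ k) ⟨
    (k ^ 2) ^ k   ≡⟨ ^-*-assoc k 2 k ⟩
    k ^ (2 * k)   ≤⟨ ^-monoʳ-≤ k {{>-nonZero (≤-trans (s≤s z≤n) 2≤k)}} 2k≤2ᵈ ⟩
    k ^ (2 ^ d)   ∎))
    where open ≤-Reasoning
... | no 2k≰2ᵈ = ≤-trans (*-monoʳ-≤ 2 (<⇒≤ (≰⇒> 2k≰2ᵈ))) (≤-reflexive (sym (*-assoc 2 2 k)))

LogPowCond∧LeExp⇒*≤ : ∀ {k d c n} → 2 ≤ k → LogPowCond k d → LeExp (k ^ suc c) n → suc c * k ≤ 2 ^ d * n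
LogPowCond∧LeExp⇒*≤ {k} {d} {c} {n} 2≤k eᵏ≤k^2ᵈ kᶜ≤eⁿ =
  LeExp∧ExpLe⇒≤ 2≤[kᶜ]^2ᵈ (LeExp-^ kᶜ≤eⁿ (2 ^ d))
    (subst (ExpLe (suc c * k)) swap (ExpLe-^ {m = k ^ (2 ^ d)} eᵏ≤k^2ᵈ (suc c)))
  where
  instance
    k≢0 : NonZero k
    k≢0 = >-nonZero (≤-trans (s≤s z≤n) 2≤k)
  swap : (k ^ (2 ^ d)) ^ suc c ≡ (k ^ suc c) ^ (2 ^ d)
  swap = trans (^-*-assoc k (2 ^ d) (suc c)) (trans (cong (k ^_) (*-comm (2 ^ d) (suc c))) (sym (^-*-assoc k (suc c) (2 ^ d))))
  2≤[kᶜ]^2ᵈ : 2 ≤ (k ^ suc c) ^ (2 ^ d)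
  2≤[kᶜ]^2ᵈ = begin
    2                       ≤⟨ 2≤k ⟩
    k                       ≤⟨ m≤m*n k (k ^ c) {{m^n≢0 k c}} ⟩
    k ^ suc c               ≡⟨ *-identityʳ (k ^ suc c) ⟨
    (k ^ suc c) ^ 1         ≤⟨ ^-monoʳ-≤ (k ^ suc c) {{m^n≢0 k (suc c)}} (m^n>0 2 d) ⟩
    (k ^ suc c) ^ (2 ^ d)   ∎
    where open ≤-Reasoning

kCκ*4^κ≤D^κ : ∀ {k κ D} → 12 * k ≤ D * κ → k C κ * 4 ^ κ ≤ D ^ κ
kCκ*4^κ≤D^κ {k} {κ} {D} 12k≤Dκ =
  *-cancelʳ-≤ _ _ (3 ^ κ * κ !) {{m*n≢0 (3 ^ κ) (κ !) {{m^n≢0 3 κ}} {{κ !≢0}}}} (begin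
  k C κ * 4 ^ κ * (3 ^ κ * κ !)    ≡⟨ lemma (k C κ) (4 ^ κ) (3 ^ κ) (κ !) ⟩
  k C κ * κ ! * (4 ^ κ * 3 ^ κ)    ≡⟨ cong (k C κ * κ ! *_) (^-distribʳ-* 4 3 κ) ⟨
  k C κ * κ ! * 12 ^ κ             ≤⟨ *-monoˡ-≤ (12 ^ κ) (nCk*k!≤n^k k κ) ⟩
  k ^ κ * 12 ^ κ                   ≡⟨ trans (cong (_^ κ) (*-comm 12 k)) (^-distribʳ-* k 12 κ) ⟨
  (12 * k) ^ κ                     ≤⟨ ^-monoˡ-≤ κ 12k≤Dκ ⟩
  (D * κ) ^ κ                      ≡⟨ ^-distribʳ-* D κ κ ⟩
  D ^ κ * κ ^ κ                    ≤⟨ *-monoʳ-≤ (D ^ κ) (≤-trans (^≤expNum κ κ) (expNum≤3^*! κ κ)) ⟩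
  D ^ κ * (3 ^ κ * κ !)            ∎)
  where
  open ≤-Reasoning
  lemma : ∀ b f t g → b * f * (t * g) ≡ b * g * (f * t)
  lemma = solve-∀

record Parameters (k κ c d1 d2 : ℕ) : Set where
  field
    k≢0 : NonZero k
    c≢0 : NonZero c
    d1≢0 : NonZero d1
    κ≤c : κ ≤ c
    k⁵≤2^d2 : k ^ 5 ≤ 2 ^ d2
    kCκ*d1*k⁴≤2*d1^κ : k C κ * d1 * k ^ 4 ≤ 2 * d1 ^ κ

parameters : ∀ {k κ d d2 c} → 2 ≤ k → IsCeilMulLn 12 k κ → IsMinLogPow k d →
             IsCeilMulLn 8 k d2 → IsCeilMulLn 13 k c → Parameters k κ c (2 ^ d) d2
parameters {k} {κ} {d} {d2} {c} 2≤k κ-ceil d-min d2-ceil c-ceil = record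
  { k≢0 = >-nonZero 1≤k
  ; c≢0 = IsCeilMulLn⇒NonZero {12} 2≤k c-ceil
  ; d1≢0 = m^n≢0 2 d
  ; κ≤c = IsCeilMulLn-mono {12} {13} {k} 1≤k (n≤1+n 12) κ-ceil c-ceil
  ; k⁵≤2^d2 = LeExp⇒^5≤2^ {k} (proj₁ d2-ceil)
  ; kCκ*d1*k⁴≤2*d1^κ = kCκ*d1*k⁴≤2*d1^κ
  }
  where
  open ≤-Reasoning
  d1 : ℕ
  d1 = 2 ^ d
  1≤k : 1 ≤ k
  1≤k = ≤-trans (s≤s z≤n) 2≤k
  k^12≤3^κ : k ^ 12 ≤ 3 ^ κ
  k^12≤3^κ = LeExp⇒≤3^ {k ^ 12} (proj₁ κ-ceil)
  d1*k⁴≤2*4^κ : d1 * k ^ 4 ≤ 2 * 4 ^ κ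
  d1*k⁴≤2*4^κ = begin
    d1 * k ^ 4          ≤⟨ *-monoˡ-≤ (k ^ 4) (IsMinLogPow⇒2^d≤4k 2≤k d-min) ⟩
    4 * k * k ^ 4       ≡⟨ lemma k (k ^ 4) ⟩
    2 * (2 * k ^ 5)     ≤⟨ *-monoʳ-≤ 2 (*-monoˡ-≤ (k ^ 5) (≤-trans 2≤k (m≤m*n k (k ^ 6) {{m^n≢0 k 6 {{>-nonZero 1≤k}}}}))) ⟩
    2 * (k ^ 7 * k ^ 5) ≡⟨ cong (2 *_) (^-distribˡ-+-* k 7 5) ⟨
    2 * k ^ 12          ≤⟨ *-monoʳ-≤ 2 k^12≤3^κ ⟩
    2 * 3 ^ κ           ≤⟨ *-monoʳ-≤ 2 (^-monoˡ-≤ κ (n≤1+n 3)) ⟩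
    2 * 4 ^ κ           ∎
    where
    lemma : ∀ k x → 4 * k * x ≡ 2 * (2 * (k * x))
    lemma = solve-∀
  kCκ*d1*k⁴≤2*d1^κ : k C κ * d1 * k ^ 4 ≤ 2 * d1 ^ κ
  kCκ*d1*k⁴≤2*d1^κ = *-cancelʳ-≤ _ _ (4 ^ κ) {{m^n≢0 4 κ}} (begin
    k C κ * d1 * k ^ 4 * 4 ^ κ     ≡⟨ lemma (k C κ) d1 (k ^ 4) (4 ^ κ) ⟩
    k C κ * 4 ^ κ * (d1 * k ^ 4)   ≤⟨ *-mono-≤ (kCκ*4^κ≤D^κ {k} {κ} 12k≤d1κ) d1*k⁴≤2*4^κ ⟩
    d1 ^ κ * (2 * 4 ^ κ)           ≡⟨ x∙yz≈y∙xz (d1 ^ κ) 2 (4 ^ κ) ⟩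
    2 * (d1 ^ κ * 4 ^ κ)           ≡⟨ *-assoc 2 (d1 ^ κ) (4 ^ κ) ⟨
    2 * d1 ^ κ * 4 ^ κ             ∎)
    where
    12k≤d1κ : 12 * k ≤ d1 * κ
    12k≤d1κ = LogPowCond∧LeExp⇒*≤ {k} {d} {11} 2≤k (proj₁ d-min) (proj₁ κ-ceil)
    lemma : ∀ b d x f → b * d * x * f ≡ b * f * (d * x)
    lemma = solve-∀

-- Counting in lists

private variable
  A X Y : Set

𝟙 : Bool → ℕ
𝟙 true  = 1
𝟙 false = 0

sumBy : (A → ℕ) → List A → ℕ
sumBy f []       = 0
sumBy f (x ∷ xs) = f x + sumBy f xs

count : (A → Bool) → List A → ℕ
count p = sumBy (𝟙 ∘ p)

sumBy-cong : ∀ {f g : A → ℕ} xs → (∀ x → x ∈ xs → f x ≡ g x) → sumBy f xs ≡ sumBy g xs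
sumBy-cong []       f≡g = refl
sumBy-cong (x ∷ xs) f≡g = cong₂ _+_ (f≡g x (here refl)) (sumBy-cong xs (λ y y∈xs → f≡g y (there y∈xs)))

sumBy-mono-≤ : ∀ {f g : A → ℕ} xs → (∀ x → x ∈ xs → f x ≤ g x) → sumBy f xs ≤ sumBy g xs
sumBy-mono-≤ []       f≤g = z≤n
sumBy-mono-≤ (x ∷ xs) f≤g = +-mono-≤ (f≤g x (here refl)) (sumBy-mono-≤ xs (λ y y∈xs → f≤g y (there y∈xs)))

sumBy-distrib-+ : ∀ (f g : A → ℕ) xs → sumBy (λ x → f x + g x) xs ≡ sumBy f xs + sumBy g xs
sumBy-distrib-+ f g []       = refl
sumBy-distrib-+ f g (x ∷ xs) =
  trans (cong (f x + g x +_) (sumBy-distrib-+ f g xs)) (+-interchange (f x) (g x) (sumBy f xs) (sumBy g xs))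

*-distribʳ-sumBy : ∀ (f : A → ℕ) c xs → sumBy f xs * c ≡ sumBy (λ x → f x * c) xs
*-distribʳ-sumBy f c []       = refl
*-distribʳ-sumBy f c (x ∷ xs) = trans (*-distribʳ-+ c (f x) (sumBy f xs)) (cong (f x * c +_) (*-distribʳ-sumBy f c xs))

sumBy-≡-const : ∀ {f : A → ℕ} {c} xs → (∀ x → x ∈ xs → f x ≡ c) → sumBy f xs ≡ length xs * c
sumBy-≡-const []       _     = refl
sumBy-≡-const (x ∷ xs) f≡c = cong₂ _+_ (f≡c x (here refl)) (sumBy-≡-const xs (λ y y∈xs → f≡c y (there y∈xs)))

sumBy-++ : ∀ (f : A → ℕ) xs ys → sumBy f (xs ++ ys) ≡ sumBy f xs + sumBy f ys
sumBy-++ f []       ys = refl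
sumBy-++ f (x ∷ xs) ys = trans (cong (f x +_) (sumBy-++ f xs ys)) (sym (+-assoc (f x) _ _))

sumBy-map : ∀ (f : Y → ℕ) (g : X → Y) xs → sumBy f (map g xs) ≡ sumBy (f ∘ g) xs
sumBy-map f g []       = refl
sumBy-map f g (x ∷ xs) = cong (f (g x) +_) (sumBy-map f g xs)

sumBy-cartesianProductWith : ∀ (f : A → ℕ) (g : X → Y → A) xs ys →
  sumBy f (cartesianProductWith g xs ys) ≡ sumBy (λ x → sumBy (f ∘ g x) ys) xs
sumBy-cartesianProductWith f g []       ys = refl
sumBy-cartesianProductWith f g (x ∷ xs) ys = begin
  sumBy f (map (g x) ys ++ cartesianProductWith g xs ys)            ≡⟨ sumBy-++ f (map (g x) ys) _ ⟩
  sumBy f (map (g x) ys) + sumBy f (cartesianProductWith g xs ys)  ≡⟨ cong₂ _+_ (sumBy-map f (g x) ys)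
                                                                         (sumBy-cartesianProductWith f g xs ys) ⟩
  sumBy (f ∘ g x) ys + sumBy (λ x → sumBy (f ∘ g x) ys) xs         ∎
  where open ≡-Reasoning

length-cartesianProductWith : ∀ (g : X → Y → A) xs ys → length (cartesianProductWith g xs ys) ≡ length xs * length ys
length-cartesianProductWith g []       ys = refl
length-cartesianProductWith g (x ∷ xs) ys = begin
  length (map (g x) ys ++ cartesianProductWith g xs ys)             ≡⟨ length-++ (map (g x) ys) ⟩
  length (map (g x) ys) + length (cartesianProductWith g xs ys)     ≡⟨ cong₂ _+_ (length-map (g x) ys)
                                                                          (length-cartesianProductWith g xs ys) ⟩
  length ys + length xs * length ys                                 ∎
  where open ≡-Reasoning

𝟙≤1 : ∀ b → 𝟙 b ≤ 1
𝟙≤1 true  = ≤-refl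
𝟙≤1 false = z≤n

count≤length : ∀ (p : A → Bool) xs → count p xs ≤ length xs
count≤length p []       = z≤n
count≤length p (x ∷ xs) = +-mono-≤ (𝟙≤1 (p x)) (count≤length p xs)

count-cong : ∀ {p q : A → Bool} xs → (∀ x → x ∈ xs → p x ≡ q x) → count p xs ≡ count q xs
count-cong xs p≡q = sumBy-cong xs (λ x x∈xs → cong 𝟙 (p≡q x x∈xs))

count-false : ∀ (xs : List A) → count (λ _ → false) xs ≡ 0
count-false xs = trans (sumBy-≡-const xs (λ _ _ → refl)) (*-zeroʳ (length xs))

length-filterᵇ≡count : ∀ (p : A → Bool) xs → length (filterᵇ p xs) ≡ count p xs
length-filterᵇ≡count p []       = refl
length-filterᵇ≡count p (x ∷ xs) with p x
... | true  = cong suc (length-filterᵇ≡count p xs)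
... | false = length-filterᵇ≡count p xs

length-filterᵇ+count-not : ∀ (p : A → Bool) xs → length (filterᵇ p xs) + count (not ∘ p) xs ≡ length xs
length-filterᵇ+count-not p []       = refl
length-filterᵇ+count-not p (x ∷ xs) with p x
... | true  = cong suc (length-filterᵇ+count-not p xs)
... | false = trans (+-suc _ _) (cong suc (length-filterᵇ+count-not p xs))

count-≤-sumBy : ∀ (p : X → Bool) (q : Y → X → Bool) xs ys →
  (∀ x → x ∈ xs → T (p x) → ∃[ y ] (y ∈ ys × T (q y x))) →
  count p xs ≤ sumBy (λ y → count (q y) xs) ys
count-≤-sumBy p q [] ys _ = ≤-reflexive (sym (trans (sumBy-≡-const ys (λ _ _ → refl)) (*-zeroʳ (length ys))))
count-≤-sumBy p q (x ∷ xs) ys cover = begin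
  𝟙 (p x) + count p xs
    ≤⟨ +-mono-≤ covered (count-≤-sumBy p q xs ys (λ x′ x′∈xs → cover x′ (there x′∈xs))) ⟩
  sumBy (λ y → 𝟙 (q y x)) ys + sumBy (λ y → count (q y) xs) ys
    ≡⟨ sumBy-distrib-+ (λ y → 𝟙 (q y x)) (λ y → count (q y) xs) ys ⟨
  sumBy (λ y → 𝟙 (q y x) + count (q y) xs) ys ∎
  where
  open ≤-Reasoning
  1≤sumBy : ∀ {y} ys → y ∈ ys → T (q y x) → 1 ≤ sumBy (λ y → 𝟙 (q y x)) ys
  1≤sumBy {y} (y′ ∷ ys) (here refl) qyx with q y x
  ... | true = s≤s z≤n
  1≤sumBy (y′ ∷ ys) (there y∈ys) qyx = ≤-trans (1≤sumBy ys y∈ys qyx) (m≤n+m _ _)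
  covered : 𝟙 (p x) ≤ sumBy (λ y → 𝟙 (q y x)) ys
  covered with p x | cover x (here refl)
  ... | false | _     = z≤n
  ... | true  | cover-x with cover-x tt
  ...   | y , y∈ys , qyx = 1≤sumBy ys y∈ys qyx

sumBy-≤-split : ∀ (h : A → Bool) (f : A → ℕ) a b xs → (∀ x → x ∈ xs → f x ≤ 𝟙 (h x) * a + b) →
  sumBy f xs ≤ count h xs * a + length xs * b
sumBy-≤-split h f a b xs f≤ = begin
  sumBy f xs                                            ≤⟨ sumBy-mono-≤ xs f≤ ⟩
  sumBy (λ x → 𝟙 (h x) * a + b) xs                      ≡⟨ sumBy-distrib-+ (λ x → 𝟙 (h x) * a) (λ _ → b) xs ⟩
  sumBy (λ x → 𝟙 (h x) * a) xs + sumBy (λ _ → b) xs     ≡⟨ cong₂ _+_ (sym (*-distribʳ-sumBy (𝟙 ∘ h) a xs)) (sumBy-≡-const xs (λ _ _ → refl)) ⟩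
  count h xs * a + length xs * b                        ∎
  where open ≤-Reasoning

allᵥ : (A → Bool) → ∀ {n} → Vec A n → Bool
allᵥ p []       = true
allᵥ p (x ∷ xs) = p x ∧ allᵥ p xs

anyᵥ : (A → Bool) → ∀ {n} → Vec A n → Bool
anyᵥ p []       = false
anyᵥ p (x ∷ xs) = p x ∨ anyᵥ p xs

not-anyᵥ : ∀ (p : A → Bool) {n} (xs : Vec A n) → not (anyᵥ p xs) ≡ allᵥ (not ∘ p) xs
not-anyᵥ p []       = refl
not-anyᵥ p (x ∷ xs) with p x
... | true  = refl
... | false = not-anyᵥ p xs

vectors : List A → ∀ n → List (Vec A n)
vectors xs zero    = [] ∷ []
vectors xs (suc n) = cartesianProductWith _∷_ xs (vectors xs n)

length-vectors : ∀ (xs : List A) n → length (vectors xs n) ≡ length xs ^ n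
length-vectors xs zero    = refl
length-vectors xs (suc n) = trans (length-cartesianProductWith _∷_ xs (vectors xs n)) (cong (length xs *_) (length-vectors xs n))

count-allᵥ-vectors : ∀ (p : A → Bool) xs n → count (allᵥ p) (vectors xs n) ≡ count p xs ^ n
count-allᵥ-vectors p xs zero    = refl
count-allᵥ-vectors p xs (suc n) = begin
  count (allᵥ p) (cartesianProductWith _∷_ xs (vectors xs n))   ≡⟨ sumBy-cartesianProductWith (𝟙 ∘ allᵥ p) _∷_ xs (vectors xs n) ⟩
  sumBy (λ x → count (λ v → p x ∧ allᵥ p v) (vectors xs n)) xs ≡⟨ sumBy-cong xs (λ x _ → head x) ⟩
  sumBy (λ x → 𝟙 (p x) * count p xs ^ n) xs                   ≡⟨ *-distribʳ-sumBy (𝟙 ∘ p) (count p xs ^ n) xs ⟨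
  count p xs * count p xs ^ n                                  ∎
  where
  open ≡-Reasoning
  head : ∀ x → count (λ v → p x ∧ allᵥ p v) (vectors xs n) ≡ 𝟙 (p x) * count p xs ^ n
  head x with p x
  ... | true  = trans (count-allᵥ-vectors p xs n) (sym (+-identityʳ _))
  ... | false = count-false (vectors xs n)

vectors-unique : ∀ {xs : List A} n → Unique xs → Unique (vectors xs n)
vectors-unique zero    _        = All.[] ∷ []
vectors-unique (suc n) xs-unique = Unique.cartesianProductWith⁺ _∷_ ∷-injective xs-unique (vectors-unique n xs-unique)

pairsOf : List A → List (A × A)
pairsOf []       = []
pairsOf (x ∷ xs) = map (x ,_) xs ++ pairsOf xs

pairsOf⁺ : ∀ {xs : List A} {y z} → y ∈ xs → z ∈ xs → y ≢ z → (y , z) ∈ pairsOf xs ⊎ (z , y) ∈ pairsOf xs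
pairsOf⁺ (here refl) (here refl) y≢z = contradiction refl y≢z
pairsOf⁺ {xs = x ∷ xs} (here refl) (there z∈xs) _ = inj₁ (∈-++⁺ˡ (∈-map⁺ (x ,_) z∈xs))
pairsOf⁺ {xs = x ∷ xs} (there y∈xs) (here refl) _ = inj₂ (∈-++⁺ˡ (∈-map⁺ (x ,_) y∈xs))
pairsOf⁺ {xs = x ∷ xs} (there y∈xs) (there z∈xs) y≢z with pairsOf⁺ y∈xs z∈xs y≢z
... | inj₁ yz∈ = inj₁ (∈-++⁺ʳ (map (x ,_) xs) yz∈)
... | inj₂ zy∈ = inj₂ (∈-++⁺ʳ (map (x ,_) xs) zy∈)

pairsOf-distinct : ∀ {xs : List A} → Unique xs → ∀ {y z} → (y , z) ∈ pairsOf xs → y ≢ z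
pairsOf-distinct {xs = x ∷ xs} (x∉xs ∷ xs-unique) yz∈ with ∈-++⁻ (map (x ,_) xs) yz∈
... | inj₂ yz∈′ = pairsOf-distinct xs-unique yz∈′
... | inj₁ yz∈′ with ∈-map⁻ (x ,_) yz∈′
...   | z , z∈xs , refl = All.lookup x∉xs z∈xs

count-pairsOf : ∀ {E : Set} (p : E → Bool) xs → count (λ (y , z) → p y ∧ p z) (pairsOf xs) ≡ count p xs C 2
count-pairsOf p []       = refl
count-pairsOf {E} p (x ∷ xs) = begin
  count both (map (x ,_) xs ++ pairsOf xs)              ≡⟨ sumBy-++ (𝟙 ∘ both) (map (x ,_) xs) (pairsOf xs) ⟩
  count both (map (x ,_) xs) + count both (pairsOf xs)  ≡⟨ cong₂ _+_ (sumBy-map (𝟙 ∘ both) (x ,_) xs) (count-pairsOf p xs) ⟩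
  count (λ z → p x ∧ p z) xs + count p xs C 2           ≡⟨ new-pairs (p x) ⟩
  (𝟙 (p x) + count p xs) C 2                            ∎
  where
  open ≡-Reasoning
  both : E × E → Bool
  both (y , z) = p y ∧ p z
  new-pairs : ∀ b → count (λ z → b ∧ p z) xs + count p xs C 2 ≡ (𝟙 b + count p xs) C 2
  new-pairs true  = trans (cong (_+ count p xs C 2) (sym (nC1≡n (count p xs)))) (nCk+nC[k+1]≡[n+1]C[k+1] (count p xs) 1)
  new-pairs false = cong (_+ count p xs C 2) (count-false xs)

combinations : List A → ∀ n → List (Vec A n)
combinations xs       zero    = [] ∷ []
combinations []       (suc n) = []
combinations (x ∷ xs) (suc n) = map (x ∷_) (combinations xs n) ++ combinations xs (suc n)

length-combinations : ∀ (xs : List A) n → length (combinations xs n) ≡ length xs C n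
length-combinations xs       zero    = refl
length-combinations []       (suc n) = refl
length-combinations (x ∷ xs) (suc n) = begin
  length (map (x ∷_) (combinations xs n) ++ combinations xs (suc n))         ≡⟨ length-++ (map (x ∷_) (combinations xs n)) ⟩
  length (map (x ∷_) (combinations xs n)) + length (combinations xs (suc n)) ≡⟨ cong₂ _+_
                                                                                   (trans (length-map (x ∷_) (combinations xs n)) (length-combinations xs n))
                                                                                   (length-combinations xs (suc n)) ⟩
  length xs C n + length xs C suc n                                          ≡⟨ nCk+nC[k+1]≡[n+1]C[k+1] (length xs) n ⟩
  suc (length xs) C suc n                                                    ∎
  where open ≡-Reasoning

combinations-complete : ∀ (p : A → Bool) xs n → n ≤ count p xs → ∃[ v ] (v ∈ combinations xs n × T (allᵥ p v))
combinations-complete p xs       zero    _  = [] , here refl , tt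
combinations-complete p (x ∷ xs) (suc n) n≤ with p x in px
... | true with combinations-complete p xs n (≤-pred n≤)
...   | v , v∈ , pv = x ∷ v , ∈-++⁺ˡ (∈-map⁺ (x ∷_) v∈) , subst (λ b → T (b ∧ allᵥ p v)) (sym px) pv
combinations-complete p (x ∷ xs) (suc n) n≤ | false with combinations-complete p xs (suc n) n≤
... | v , v∈ , pv = v , ∈-++⁺ʳ (map (x ∷_) (combinations xs n)) v∈ , pv

combinations-⊆ : ∀ (xs : List A) n {v} → v ∈ combinations xs n → ∀ i → lookupᵥ v i ∈ xs
combinations-⊆ (x ∷ xs) (suc n) v∈ i with ∈-++⁻ (map (x ∷_) (combinations xs n)) v∈
... | inj₂ v∈′ = there (combinations-⊆ xs (suc n) v∈′ i)
... | inj₁ v∈′ with ∈-map⁻ (x ∷_) v∈′ | i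
...   | v′ , v′∈ , refl | zero  = here refl
...   | v′ , v′∈ , refl | suc i′ = there (combinations-⊆ xs n v′∈ i′)

combinations-injective : ∀ {xs : List A} → Unique xs → ∀ n {v} → v ∈ combinations xs n →
  ∀ {i j} → lookupᵥ v i ≡ lookupᵥ v j → i ≡ j
combinations-injective {xs = x ∷ xs} (x∉xs ∷ xs-unique) (suc n) v∈ with ∈-++⁻ (map (x ∷_) (combinations xs n)) v∈
... | inj₂ v∈′ = combinations-injective xs-unique (suc n) v∈′
... | inj₁ v∈′ with ∈-map⁻ (x ∷_) v∈′
...   | v′ , v′∈ , refl = injective
  where
  fresh : ∀ i → x ≢ lookupᵥ v′ i
  fresh i = All.lookup x∉xs (combinations-⊆ xs n v′∈ i)
  injective : ∀ {i j} → lookupᵥ (x ∷ v′) i ≡ lookupᵥ (x ∷ v′) j → i ≡ j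
  injective {zero}  {zero}  _  = refl
  injective {zero}  {suc j} eq = contradiction eq (fresh j)
  injective {suc i} {zero}  eq = contradiction (sym eq) (fresh i)
  injective {suc i} {suc j} eq = cong suc (combinations-injective xs-unique n v′∈ eq)

lookup-injective : ∀ {xs : List A} → Unique xs → ∀ {i j} → lookup xs i ≡ lookup xs j → i ≡ j
lookup-injective {xs = x ∷ xs} _ {zero} {zero} _ = refl
lookup-injective {xs = x ∷ xs} (x∉xs ∷ _) {zero}  {suc j} eq = contradiction eq (All.lookup x∉xs (∈-lookup j))
lookup-injective {xs = x ∷ xs} (x∉xs ∷ _) {suc i} {zero}  eq = contradiction (sym eq) (All.lookup x∉xs (∈-lookup i))
lookup-injective {xs = x ∷ xs} (_ ∷ xs-unique) {suc i} {suc j} eq = cong suc (lookup-injective xs-unique eq)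

elements : ∀ {n} → Subset n → List (Fin n)
elements []          = []
elements (true ∷ p)  = zero ∷ map suc (elements p)
elements (false ∷ p) = map suc (elements p)

length-elements : ∀ {n} (p : Subset n) → length (elements p) ≡ ∣ p ∣
length-elements []          = refl
length-elements (true ∷ p)  = cong suc (trans (length-map suc (elements p)) (length-elements p))
length-elements (false ∷ p) = trans (length-map suc (elements p)) (length-elements p)

elements⁺ : ∀ {n} {p : Subset n} {x} → x ∈ₛ p → x ∈ elements p
elements⁺ {p = true ∷ p}  Data.Vec.here        = here refl
elements⁺ {p = true ∷ p}  (Data.Vec.there x∈p) = there (∈-map⁺ suc (elements⁺ x∈p))
elements⁺ {p = false ∷ p} (Data.Vec.there x∈p) = ∈-map⁺ suc (elements⁺ x∈p)

elements⁻ : ∀ {n} {p : Subset n} {x} → x ∈ elements p → x ∈ₛ p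
elements⁻ {p = true ∷ p}  (here refl) = Data.Vec.here
elements⁻ {p = true ∷ p}  (there x∈)  with ∈-map⁻ suc x∈
... | y , y∈ , refl = Data.Vec.there (elements⁻ y∈)
elements⁻ {p = false ∷ p} x∈          with ∈-map⁻ suc x∈
... | y , y∈ , refl = Data.Vec.there (elements⁻ y∈)

elements-unique : ∀ {n} (p : Subset n) → Unique (elements p)
elements-unique []          = []
elements-unique (true ∷ p)  = All.tabulate 0≢ ∷ Unique.map⁺ suc-injectiveᶠ (elements-unique p)
  where
  0≢ : ∀ {x} → x ∈ map suc (elements p) → zero ≢ x
  0≢ x∈ refl with ∈-map⁻ suc x∈
  ... | _ , _ , ()
elements-unique (false ∷ p) = Unique.map⁺ suc-injectiveᶠ (elements-unique p)

first : (p : A → Bool) → ∀ {n} (xs : Vec A n) → T (anyᵥ p xs) → Fin n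
first p (x ∷ xs) any-p with p x
... | true  = zero
... | false = suc (first p xs any-p)

first-satisfies : ∀ (p : A → Bool) {n} (xs : Vec A n) (any-p : T (anyᵥ p xs)) → T (p (lookupᵥ xs (first p xs any-p)))
first-satisfies p (x ∷ xs) any-p with p x in px
... | true  = subst T (sym px) tt
... | false = first-satisfies p xs any-p

first-irrelevant : ∀ (p : A → Bool) {n} (xs : Vec A n) (t t′ : T (anyᵥ p xs)) → first p xs t ≡ first p xs t′
first-irrelevant p (x ∷ xs) t t′ with p x
... | true  = refl
... | false = cong suc (first-irrelevant p xs t t′)

all-allFin-lookup : ∀ (p : A → Bool) {n} (xs : Vec A n) → all (λ i → p (lookupᵥ xs i)) (allFin n) ≡ allᵥ p xs
all-allFin-lookup p []       = refl
all-allFin-lookup p {suc n} (x ∷ xs) = cong (p x ∧_) (trans (cong and (trans (map-tabulate suc g) (sym (map-tabulate id (g ∘ suc)))))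
                                                    (all-allFin-lookup p xs))
  where
  g : Fin (suc n) → Bool
  g i = p (lookupᵥ (x ∷ xs) i)

T-not⇒¬T : ∀ {b} → T (not b) → ¬ T b
T-not⇒¬T {false} _ ()

T-not-all⇒∃ : ∀ (p : A → Bool) xs → T (not (all p xs)) → ∃[ x ] (x ∈ xs × T (not (p x)))
T-not-all⇒∃ p (x ∷ xs) not-all with p x in px
... | false = x , here refl , subst (T ∘ not) (sym px) tt
... | true with T-not-all⇒∃ p xs not-all
...   | y , y∈xs , not-py = y , there y∈xs , not-py

-- Good samples

divMod-unique : ∀ {m q q′ r r′} → r < m → r′ < m → q * m + r ≡ q′ * m + r′ → q ≡ q′ × r ≡ r′
divMod-unique {m} {q} {q′} {r} {r′} r<m r′<m eq =
  *-cancelʳ-≡ q q′ m (+-cancelʳ-≡ _ _ _ (trans eq (cong (q′ * m +_) (sym r≡r′)))) , r≡r′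
  where
  instance
    m≢0 : NonZero m
    m≢0 = >-nonZero (≤-trans (s≤s z≤n) r<m)
  remainder : ∀ {q r} → r < m → (q * m + r) % m ≡ r
  remainder {q} {r} r<m = trans (cong (_% m) (+-comm (q * m) r)) (trans ([m+kn]%n≡m%n r q m) (m<n⇒m%n≡m r<m))
  r≡r′ : r ≡ r′
  r≡r′ = trans (sym (remainder {q} r<m)) (trans (cong (_% m) eq) (remainder {q′} r′<m))

mixedRadix-injective : ∀ {d2 d3 a a′ b b′ c c′} → b < d2 → b′ < d2 → c < d3 → c′ < d3 →
  a * d2 * d3 + b * d3 + c ≡ a′ * d2 * d3 + b′ * d3 + c′ → a ≡ a′ × b ≡ b′ × c ≡ c′
mixedRadix-injective {d2} {d3} {a} {a′} {b} {b′} {c} {c′} b<d2 b′<d2 c<d3 c′<d3 eq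
  with divMod-unique c<d3 c′<d3
         (subst₂ (λ l r → l + c ≡ r + c′) (sym (*-distribʳ-+ d3 (a * d2) b)) (sym (*-distribʳ-+ d3 (a′ * d2) b′)) eq)
... | high≡ , c≡c′ with divMod-unique b<d2 b′<d2 high≡
...   | a≡a′ , b≡b′ = a≡a′ , b≡b′ , c≡c′

mixedRadix-< : ∀ {d1 d2 d3 a b c} → a < d1 → b < d2 → c < d3 → a * d2 * d3 + b * d3 + c < d1 * d2 * d3
mixedRadix-< {d1} {d2} {d3} {a} {b} {c} a<d1 b<d2 c<d3 = begin-strict
  a * d2 * d3 + b * d3 + c       ≡⟨ +-assoc (a * d2 * d3) (b * d3) c ⟩
  a * d2 * d3 + (b * d3 + c)     <⟨ +-monoʳ-< (a * d2 * d3) (digit b<d2 c<d3) ⟩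
  a * d2 * d3 + d2 * d3          ≡⟨ cong (_+ d2 * d3) (*-assoc a d2 d3) ⟩
  a * (d2 * d3) + d2 * d3        ≡⟨ +-comm (a * (d2 * d3)) (d2 * d3) ⟩
  suc a * (d2 * d3)              ≤⟨ *-monoˡ-≤ (d2 * d3) a<d1 ⟩
  d1 * (d2 * d3)                 ≡⟨ *-assoc d1 d2 d3 ⟨
  d1 * d2 * d3                   ∎
  where
  open ≤-Reasoning
  digit : ∀ {m n b c} → b < m → c < n → b * n + c < m * n
  digit {m} {n} {b} {c} b<m c<n = begin-strict
    b * n + c   <⟨ +-monoʳ-< (b * n) c<n ⟩
    b * n + n   ≡⟨ +-comm (b * n) n ⟩
    suc b * n   ≤⟨ *-monoˡ-≤ n b<m ⟩
    m * n       ∎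

module _ {u d1 d2 d3} {f : Fin u → Fin d1} {hs : Fin d2 → Fin u → Fin d3} where

  hplus-injective : ∀ {i i′ x x′} → hplus f hs i x ≡ hplus f hs i′ x′ →
                    f x ≡ f x′ × i ≡ i′ × hs i x ≡ hs i′ x′
  hplus-injective eq with mixedRadix-injective (toℕ<n _) (toℕ<n _) (toℕ<n _) (toℕ<n _) eq
  ... | e₁ , e₂ , e₃ = toℕ-injective e₁ , toℕ-injective e₂ , toℕ-injective e₃

  hplus< : ∀ i x → hplus f hs i x < d1 * d2 * d3
  hplus< i x = mixedRadix-< (toℕ<n (f x)) (toℕ<n i) (toℕ<n (hs i x))

module Scheme {u d1 d2 d3 nF nH : ℕ} (S : Subset u) (F : Fin nF → Fin u → Fin d1) (H : Fin nH → Fin u → Fin d3) where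

  elemsS : List (Fin u)
  elemsS = elements S

  collides : (Fin u → Fin d1) → (Fin u → Fin d3) → Fin d1 → Fin u × Fin u → Bool
  collides f g b (y , z) = ⌊ f y ≟ᶠ b ⌋ ∧ ⌊ f z ≟ᶠ b ⌋ ∧ ⌊ g y ≟ᶠ g z ⌋

  separates : (Fin u → Fin d1) → (Fin u → Fin d3) → Fin d1 → Bool
  separates f g b = not (any (collides f g b) (pairsOf elemsS))

  collides-≡ : ∀ {f g b y z} → f y ≡ b → f z ≡ b → g y ≡ g z → T (collides f g b (y , z))
  collides-≡ {f} {g} {b} {y} {z} fy≡b fz≡b gy≡gz =
    Equivalence.from (T-∧ {⌊ f y ≟ᶠ b ⌋}) (fromWitness fy≡b ,
      Equivalence.from (T-∧ {⌊ f z ≟ᶠ b ⌋}) (fromWitness fz≡b , fromWitness gy≡gz))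

  separates⇒injective : ∀ {f g b y z} → T (separates f g b) → y ∈ elemsS → z ∈ elemsS →
    f y ≡ b → f z ≡ b → g y ≡ g z → y ≡ z
  separates⇒injective {f} {g} {b} {y} {z} sep y∈ z∈ fy≡b fz≡b gy≡gz with y ≟ᶠ z
  ... | yes y≡z = y≡z
  ... | no  y≢z with pairsOf⁺ y∈ z∈ y≢z
  ...   | inj₁ yz∈ = contradiction (any⁺ _ (lose yz∈ (collides-≡ {f} {g} fy≡b fz≡b gy≡gz))) (T-not⇒¬T sep)
  ...   | inj₂ zy∈ = contradiction (any⁺ _ (lose zy∈ (collides-≡ {f} {g} fz≡b fy≡b (sym gy≡gz)))) (T-not⇒¬T sep)

  separatedBy : Fin nF → Fin d1 → Fin nH → Bool
  separatedBy ι b j = separates (F ι) (H j) b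

  good : Sample nF nH d2 → Bool
  good (ι , js) = all (λ x → anyᵥ (separatedBy ι (F ι x)) js) elemsS

  module Witness (ι : Fin nF) (js : Vec (Fin nH) d2) (all-good : T (good (ι , js))) where
    f : Fin u → Fin d1
    f = F ι
    hs : Fin d2 → Fin u → Fin d3
    hs i = H (lookupᵥ js i)
    s : Fin (length elemsS) → Fin u
    s = lookup elemsS
    s∈ : ∀ i → s i ∈ elemsS
    s∈ = ∈-lookup
    separable : ∀ x → x ∈ elemsS → T (anyᵥ (separatedBy ι (f x)) js)
    separable x x∈ = All.lookup (all⁺ _ elemsS all-good) x∈

    -- The first separating index is a function of the bucket alone, so all elements of
    -- a bucket are hashed by the same hᵢ.
    I : Fin (length elemsS) → Fin d2
    I i = first (separatedBy ι (f (s i))) js (separable (s i) (s∈ i))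
    I-separates : ∀ i → T (separates f (hs (I i)) (f (s i)))
    I-separates i = first-satisfies (separatedBy ι (f (s i))) js (separable (s i) (s∈ i))
    first-cong : ∀ {b b′} → b ≡ b′ → ∀ t t′ → first (separatedBy ι b) js t ≡ first (separatedBy ι b′) js t′
    first-cong {b} refl = first-irrelevant (separatedBy ι b) js
    I-cong : ∀ {i j} → f (s i) ≡ f (s j) → I i ≡ I j
    I-cong eq = first-cong eq _ _

    q : Fin (length elemsS) → Fin (d1 * d2 * d3)
    q i = fromℕ< (hplus< {f = f} {hs} (I i) (s i))
    decode : ∀ {i i′ x} → hplus f hs i′ x ≡ toℕ (q i) → f x ≡ f (s i) × i′ ≡ I i × hs i′ x ≡ hs (I i) (s i)
    decode eq = hplus-injective {f = f} {hs = hs} (trans eq (toℕ-fromℕ< _))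

    disjoint : ∀ i j → i ≢ j → ∀ x → InHinv f hs (toℕ (q i)) x → InHinv f hs (toℕ (q j)) x → ⊥
    disjoint i j i≢j x (i₁ , e₁) (i₂ , e₂) with decode {i} e₁ | decode {j} e₂
    ... | fx≡fsi , refl , hx≡hsi | fx≡fsj , refl , hx≡hsj = i≢j (lookup-injective (elements-unique S)
          (separates⇒injective {f} {hs (I i)} (I-separates i) (s∈ i) (s∈ j) refl (trans (sym fx≡fsj) fx≡fsi) collision))
      where
      Ij≡Ii : I j ≡ I i
      Ij≡Ii = I-cong (trans (sym fx≡fsj) fx≡fsi)
      collision : hs (I i) (s i) ≡ hs (I i) (s j)
      collision = begin
        hs (I i) (s i) ≡⟨ hx≡hsi ⟨
        hs (I i) x     ≡⟨ cong (λ k → hs k x) Ij≡Ii ⟨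
        hs (I j) x     ≡⟨ hx≡hsj ⟩
        hs (I j) (s j) ≡⟨ cong (λ k → hs k (s j)) Ij≡Ii ⟩
        hs (I i) (s j) ∎
        where open ≡-Reasoning

    isolates : ∀ i → ∃[ x ] (x ∈ₛ S × InHinv f hs (toℕ (q i)) x
                             × (∀ y → y ∈ₛ S → InHinv f hs (toℕ (q i)) y → y ≡ x))
    isolates i = s i , elements⁻ (s∈ i) , (I i , sym (toℕ-fromℕ< _)) , unique
      where
      unique : ∀ y → y ∈ₛ S → InHinv f hs (toℕ (q i)) y → y ≡ s i
      unique y y∈S (i₁ , e₁) with decode {i} e₁
      ... | fy≡fsi , refl , hy≡hsi =
        separates⇒injective {f} {hs (I i)} (I-separates i) (elements⁺ y∈S) (s∈ i) fy≡fsi refl hy≡hsi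

  good-sound : ∀ ι js → T (good (ι , js)) → GoodEvent (F ι) (λ i → H (lookupᵥ js i)) S (length elemsS)
  good-sound ι js all-good = q , disjoint , isolates
    where open Witness ι js all-good

-- Counting bad samples

module Counting {u d1 d2 c nF nH : ℕ} (S : Subset u) (F : Fin nF → Fin u → Fin d1)
  (H : Fin nH → Fin u → Fin (c * c)) where

  open Scheme {d2 = d2} S F H

  hashVectors : List (Vec (Fin nH) d2)
  hashVectors = vectors (allFin nH) d2

  samples : List (Sample nF nH d2)
  samples = cartesianProduct (allFin nF) hashVectors

  badVectors : Fin nF → ℕ
  badVectors ι = count (λ js → not (good (ι , js))) hashVectors

  load : Fin nF → Fin d1 → ℕ
  load ι b = count (λ y → ⌊ F ι y ≟ᶠ b ⌋) elemsS

  module _ (κ : ℕ) where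

    overloaded : Fin nF → Bool
    overloaded ι = any (λ x → κ ≤ᵇ load ι (F ι x)) elemsS

  nonseparating : Fin nF → Fin d1 → ℕ
  nonseparating ι b = count (λ j → not (separatedBy ι b j)) (allFin nH)

  module _ (H-univ : Universal H) where

    nonseparating*c²≤ : ∀ ι b → nonseparating ι b * (c * c) ≤ load ι b C 2 * nH
    nonseparating*c²≤ ι b = begin
      nonseparating ι b * (c * c)
        ≡⟨ cong (_* (c * c)) (count-cong (allFin nH) (λ j _ → not-involutive _)) ⟩
      count (λ j → any (collision j) pairs) (allFin nH) * (c * c)
        ≤⟨ *-monoˡ-≤ (c * c) (count-≤-sumBy _ (λ pr j → collision j pr) (allFin nH) pairs
                                (λ j _ any-collision → find (any⁻ (collision j) pairs any-collision))) ⟩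
      sumBy (λ pr → count (λ j → collision j pr) (allFin nH)) pairs * (c * c)
        ≡⟨ *-distribʳ-sumBy _ (c * c) pairs ⟩
      sumBy (λ pr → count (λ j → collision j pr) (allFin nH) * (c * c)) pairs
        ≤⟨ sumBy-mono-≤ pairs pair-bound ⟩
      sumBy (λ (y , z) → 𝟙 (inBucket y ∧ inBucket z) * nH) pairs
        ≡⟨ *-distribʳ-sumBy _ nH pairs ⟨
      count (λ (y , z) → inBucket y ∧ inBucket z) pairs * nH
        ≡⟨ cong (_* nH) (count-pairsOf inBucket elemsS) ⟩
      load ι b C 2 * nH ∎
      where
      open ≤-Reasoning
      pairs : List (Fin u × Fin u)
      pairs = pairsOf elemsS
      collision : Fin nH → Fin u × Fin u → Bool
      collision j = collides (F ι) (H j) b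
      inBucket : Fin u → Bool
      inBucket y = ⌊ F ι y ≟ᶠ b ⌋
      pair-bound : ∀ pr → pr ∈ pairs →
                   count (λ j → collision j pr) (allFin nH) * (c * c) ≤ 𝟙 (inBucket (proj₁ pr) ∧ inBucket (proj₂ pr)) * nH
      pair-bound (y , z) yz∈ with ⌊ F ι y ≟ᶠ b ⌋ | ⌊ F ι z ≟ᶠ b ⌋
      ... | true  | true  = begin
        count (λ j → ⌊ H j y ≟ᶠ H j z ⌋) (allFin nH) * (c * c) ≡⟨ cong (_* (c * c)) (length-filterᵇ≡count _ (allFin nH)) ⟨
        countᶠ (λ j → ⌊ H j y ≟ᶠ H j z ⌋) * (c * c)           ≤⟨ H-univ y z (pairsOf-distinct (elements-unique S) yz∈) ⟩
        nH                                                     ≡⟨ +-identityʳ nH ⟨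
        1 * nH                                                 ∎
      ... | true  | false = ≤-reflexive (cong (_* (c * c)) (count-false (allFin nH)))
      ... | false | _     = ≤-reflexive (cong (_* (c * c)) (count-false (allFin nH)))

    nonseparating*2≤ : .{{NonZero c}} → ∀ ι b → load ι b ≤ c → nonseparating ι b * 2 ≤ nH
    nonseparating*2≤ ι b load≤c = *-cancelʳ-≤ _ _ (c * c) {{m*n≢0 c c}} (begin
      nonseparating ι b * 2 * (c * c)   ≡⟨ xy∙z≈xz∙y (nonseparating ι b) 2 (c * c) ⟩
      nonseparating ι b * (c * c) * 2   ≤⟨ *-monoˡ-≤ 2 (nonseparating*c²≤ ι b) ⟩
      load ι b C 2 * nH * 2             ≡⟨ xy∙z≈xz∙y (load ι b C 2) nH 2 ⟩
      load ι b C 2 * 2 * nH             ≤⟨ *-monoˡ-≤ nH (nCk*k!≤n^k (load ι b) 2) ⟩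
      load ι b ^ 2 * nH                 ≤⟨ *-monoˡ-≤ nH (^-monoˡ-≤ 2 load≤c) ⟩
      c ^ 2 * nH                        ≡⟨ cong (λ x → c * x * nH) (*-identityʳ c) ⟩
      c * c * nH                        ≡⟨ *-comm (c * c) nH ⟩
      nH * (c * c)                      ∎)
      where open ≤-Reasoning

    badVectors*2^d2≤ : .{{NonZero c}} → ∀ {κ} → κ ≤ c → ∀ ι → T (not (overloaded κ ι)) →
                       badVectors ι * 2 ^ d2 ≤ length elemsS * nH ^ d2
    badVectors*2^d2≤ {κ} κ≤c ι not-overloaded = begin
      badVectors ι * 2 ^ d2
        ≤⟨ *-monoˡ-≤ (2 ^ d2) (count-≤-sumBy _ unseparated hashVectors elemsS bad⇒unseparated) ⟩
      sumBy (λ x → count (unseparated x) hashVectors) elemsS * 2 ^ d2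
        ≡⟨ *-distribʳ-sumBy _ (2 ^ d2) elemsS ⟩
      sumBy (λ x → count (unseparated x) hashVectors * 2 ^ d2) elemsS
        ≤⟨ sumBy-mono-≤ elemsS (λ x x∈ → ≤-trans (≤-reflexive (per-element x))
                                                 (^-monoˡ-≤ d2 (nonseparating*2≤ ι (F ι x) (load≤c x x∈)))) ⟩
      sumBy (λ _ → nH ^ d2) elemsS
        ≡⟨ sumBy-≡-const elemsS (λ _ _ → refl) ⟩
      length elemsS * nH ^ d2 ∎
      where
      open ≤-Reasoning
      unseparated : Fin u → Vec (Fin nH) d2 → Bool
      unseparated x = allᵥ (not ∘ separatedBy ι (F ι x))
      bad⇒unseparated : ∀ js → js ∈ hashVectors → T (not (good (ι , js))) → ∃[ x ] (x ∈ elemsS × T (unseparated x js))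
      bad⇒unseparated js _ not-good with T-not-all⇒∃ _ elemsS not-good
      ... | x , x∈ , not-any = x , x∈ , subst T (not-anyᵥ (separatedBy ι (F ι x)) js) not-any
      per-element : ∀ x → count (unseparated x) hashVectors * 2 ^ d2 ≡ (nonseparating ι (F ι x) * 2) ^ d2
      per-element x = trans (cong (_* 2 ^ d2) (count-allᵥ-vectors _ (allFin nH) d2)) (sym (^-distribʳ-* _ 2 d2))
      load≤c : ∀ x → x ∈ elemsS → load ι (F ι x) ≤ c
      load≤c x x∈ with κ ≤? load ι (F ι x)
      ... | yes κ≤load = contradiction (any⁺ _ (lose x∈ (≤⇒≤ᵇ κ≤load))) (T-not⇒¬T not-overloaded)
      ... | no  κ≰load = ≤-trans (<⇒≤ (≰⇒> κ≰load)) κ≤c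

  overloaded*d1^κ≤ : ∀ {κ} → KWiseIndependent κ F → count (overloaded κ) (allFin nF) * d1 ^ κ ≤ length elemsS C κ * d1 * nF
  overloaded*d1^κ≤ {κ} F-indep = begin
    count (overloaded κ) (allFin nF) * d1 ^ κ
      ≤⟨ *-monoˡ-≤ (d1 ^ κ) (count-≤-sumBy (overloaded κ) constant (allFin nF) cases overloaded⇒constant) ⟩
    sumBy (λ cb → count (constant cb) (allFin nF)) cases * d1 ^ κ
      ≡⟨ *-distribʳ-sumBy _ (d1 ^ κ) cases ⟩
    sumBy (λ cb → count (constant cb) (allFin nF) * d1 ^ κ) cases
      ≡⟨ sumBy-≡-const cases (λ (v , b) vb∈ → independence v b (∈cases⇒ vb∈)) ⟩
    length cases * nF
      ≡⟨ cong (_* nF) (trans (length-cartesianProductWith _,_ (combinations elemsS κ) (allFin d1))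
                            (cong₂ _*_ (length-combinations elemsS κ) (length-tabulate {n = d1} id))) ⟩
    length elemsS C κ * d1 * nF ∎
    where
    open ≤-Reasoning
    cases : List (Vec (Fin u) κ × Fin d1)
    cases = cartesianProduct (combinations elemsS κ) (allFin d1)
    constant : Vec (Fin u) κ × Fin d1 → Fin nF → Bool
    constant (v , b) ι = allᵥ (λ y → ⌊ F ι y ≟ᶠ b ⌋) v
    overloaded⇒constant : ∀ ι → ι ∈ allFin nF → T (overloaded κ ι) → ∃[ cb ] (cb ∈ cases × T (constant cb ι))
    overloaded⇒constant ι _ is-overloaded with find (any⁻ _ elemsS is-overloaded)
    ... | x , _ , κ≤load with combinations-complete (λ y → ⌊ F ι y ≟ᶠ F ι x ⌋) elemsS κ (≤ᵇ⇒≤ κ _ κ≤load)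
    ...   | v , v∈ , all-in-bucket = (v , F ι x) , ∈-cartesianProduct⁺ v∈ (∈-allFin (F ι x)) , all-in-bucket
    ∈cases⇒ : ∀ {v b} → (v , b) ∈ cases → v ∈ combinations elemsS κ
    ∈cases⇒ vb∈ with ∈-cartesianProductWith⁻ _,_ (combinations elemsS κ) (allFin d1) vb∈
    ... | _ , _ , v∈ , _ , refl = v∈
    independence : ∀ v b → v ∈ combinations elemsS κ → count (constant (v , b)) (allFin nF) * d1 ^ κ ≡ nF
    independence v b v∈ = trans (cong (_* d1 ^ κ) count≡countᶠ)
      (F-indep (lookupᵥ v) (combinations-injective (elements-unique S) κ v∈) (λ _ → b))
      where
      count≡countᶠ : count (constant (v , b)) (allFin nF)
                   ≡ countᶠ (λ ι → all (λ i → ⌊ F ι (lookupᵥ v i) ≟ᶠ b ⌋) (allFin κ))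
      count≡countᶠ = sym (trans (length-filterᵇ≡count _ (allFin nF))
        (count-cong (allFin nF) (λ ι _ → all-allFin-lookup (λ y → ⌊ F ι y ≟ᶠ b ⌋) v)))

  module _ {k κ} (P : Parameters k κ c d1 d2) (|S|≡k : length elemsS ≡ k) where
    open Parameters P

    overloaded*k⁴≤2nF : KWiseIndependent κ F → count (overloaded κ) (allFin nF) * k ^ 4 ≤ 2 * nF
    overloaded*k⁴≤2nF F-indep = *-cancelʳ-≤ _ _ (d1 ^ κ) {{m^n≢0 d1 κ {{d1≢0}}}} (begin
      o * k ^ 4 * d1 ^ κ           ≡⟨ xy∙z≈xz∙y o (k ^ 4) (d1 ^ κ) ⟩
      o * d1 ^ κ * k ^ 4           ≤⟨ *-monoˡ-≤ (k ^ 4) (overloaded*d1^κ≤ F-indep) ⟩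
      length elemsS C κ * d1 * nF * k ^ 4 ≡⟨ cong (λ n → n C κ * d1 * nF * k ^ 4) |S|≡k ⟩
      k C κ * d1 * nF * k ^ 4      ≡⟨ xy∙z≈xz∙y (k C κ * d1) nF (k ^ 4) ⟩
      k C κ * d1 * k ^ 4 * nF      ≤⟨ *-monoˡ-≤ nF kCκ*d1*k⁴≤2*d1^κ ⟩
      2 * d1 ^ κ * nF              ≡⟨ xy∙z≈xz∙y 2 (d1 ^ κ) nF ⟩
      2 * nF * d1 ^ κ              ∎)
      where
      open ≤-Reasoning
      o : ℕ
      o = count (overloaded κ) (allFin nF)

    badVectors*k⁴≤ : Universal H → ∀ ι → T (not (overloaded κ ι)) → badVectors ι * k ^ 4 ≤ nH ^ d2
    badVectors*k⁴≤ H-univ ι not-overloaded = *-cancelʳ-≤ _ _ k {{k≢0}} (begin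
      badVectors ι * k ^ 4 * k      ≡⟨ xy∙z≈x∙zy (badVectors ι) (k ^ 4) k ⟩
      badVectors ι * k ^ 5          ≤⟨ *-monoʳ-≤ (badVectors ι) k⁵≤2^d2 ⟩
      badVectors ι * 2 ^ d2         ≤⟨ badVectors*2^d2≤ H-univ {{c≢0}} κ≤c ι not-overloaded ⟩
      length elemsS * nH ^ d2 ≡⟨ cong (_* nH ^ d2) |S|≡k ⟩
      k * nH ^ d2            ≡⟨ *-comm k (nH ^ d2) ⟩
      nH ^ d2 * k            ∎)
      where open ≤-Reasoning

    bad-samples*k⁴≤ : KWiseIndependent κ F → Universal H → count (not ∘ good) samples * k ^ 4 ≤ 3 * (nF * nH ^ d2)
    bad-samples*k⁴≤ F-indep H-univ = begin
      count (not ∘ good) samples * k ^ 4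
        ≡⟨ cong (_* k ^ 4) (sumBy-cartesianProductWith (𝟙 ∘ not ∘ good) _,_ (allFin nF) hashVectors) ⟩
      sumBy badVectors (allFin nF) * k ^ 4
        ≡⟨ *-distribʳ-sumBy badVectors (k ^ 4) (allFin nF) ⟩
      sumBy (λ ι → badVectors ι * k ^ 4) (allFin nF)
        ≤⟨ sumBy-≤-split (overloaded κ) _ (nH ^ d2 * k ^ 4) (nH ^ d2) (allFin nF) bad-ι ⟩
      o * (nH ^ d2 * k ^ 4) + length (allFin nF) * nH ^ d2
        ≡⟨ cong₂ _+_ (x∙yz≈xz∙y o (nH ^ d2) (k ^ 4)) (cong (_* nH ^ d2) (length-tabulate {n = nF} id)) ⟩
      o * k ^ 4 * nH ^ d2 + nF * nH ^ d2
        ≤⟨ +-monoˡ-≤ (nF * nH ^ d2) (*-monoˡ-≤ (nH ^ d2) (overloaded*k⁴≤2nF F-indep)) ⟩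
      2 * nF * nH ^ d2 + nF * nH ^ d2
        ≡⟨ lemma nF (nH ^ d2) ⟩
      3 * (nF * nH ^ d2) ∎
      where
      open ≤-Reasoning
      o : ℕ
      o = count (overloaded κ) (allFin nF)
      lemma : ∀ a b → 2 * a * b + a * b ≡ 3 * (a * b)
      lemma = solve-∀
      bad≤ : ∀ ι → badVectors ι ≤ nH ^ d2
      bad≤ ι = ≤-trans (count≤length _ hashVectors)
        (≤-reflexive (trans (length-vectors (allFin nH) d2) (cong (_^ d2) (length-tabulate {n = nH} id))))
      bad-ι : ∀ ι → ι ∈ allFin nF → badVectors ι * k ^ 4 ≤ 𝟙 (overloaded κ ι) * (nH ^ d2 * k ^ 4) + nH ^ d2
      bad-ι ι _ with overloaded κ ι in eq
      ... | true  = ≤-trans (*-monoˡ-≤ (k ^ 4) (bad≤ ι))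
                      (≤-trans (≤-reflexive (sym (*-identityˡ _))) (m≤m+n (1 * (nH ^ d2 * k ^ 4)) (nH ^ d2)))
      ... | false = badVectors*k⁴≤ H-univ ι (subst (T ∘ not) (sym eq) tt)

  good-samples-unique : Unique (filterᵇ good samples)
  good-samples-unique = Unique.filter⁺ (T? ∘ good)
    (Unique.cartesianProduct⁺ (Unique.allFin⁺ nF) (vectors-unique d2 (Unique.allFin⁺ nH)))

  good-samples-good : ∀ {k} → length elemsS ≡ k → All (GoodSample F H S k) (filterᵇ good samples)
  good-samples-good |S|≡k = All.map (λ {(ι , js)} is-good → subst (GoodEvent (F ι) (λ i → H (lookupᵥ js i)) S) |S|≡k
                                                               (good-sound ι js is-good))
                                    (all-filter (T? ∘ good) samples)

  samples∸good≡bad : nF * nH ^ d2 ∸ length (filterᵇ good samples) ≡ count (not ∘ good) samples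
  samples∸good≡bad = trans (cong (_∸ length (filterᵇ good samples))
                                 (trans (sym length-samples) (sym (length-filterᵇ+count-not good samples))))
                           (m+n∸m≡n (length (filterᵇ good samples)) (count (not ∘ good) samples))
    where
    length-samples : length samples ≡ nF * nH ^ d2
    length-samples = trans (length-cartesianProductWith _,_ (allFin nF) hashVectors)
      (cong₂ _*_ (length-tabulate {n = nF} id)
                 (trans (length-vectors (allFin nH) d2) (cong (_^ d2) (length-tabulate {n = nH} id))))

theorem4p2 : (u k : ℕ) → 2 ≤ k → (S : Subset u) → ∣ S ∣ ≡ k →
    (κ d d2 c13 : ℕ) → IsCeilMulLn 12 k κ → IsMinLogPow k d →
    IsCeilMulLn 8 k d2 → IsCeilMulLn 13 k c13 →
    (nF : ℕ) (F : Fin nF → Fin u → Fin (2 ^ d)) → 1 ≤ nF → KWiseIndependent κ F →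
    (nH : ℕ) (H : Fin nH → Fin u → Fin (c13 * c13)) → 1 ≤ nH → Universal H →
    ∃[ L ] (Unique L × All (GoodSample {d2 = d2} F H S k) L
      × LeExp (k ^ ((nF * nH ^ d2 ∸ length L) * k ^ 3)) (4 * (nF * nH ^ d2)))
theorem4p2 u k 2≤k S ∣S∣≡k κ d d2 c κ-ceil d-min d2-ceil c-ceil nF F _ F-indep nH H _ H-univ =
  filterᵇ good samples , good-samples-unique , good-samples-good |elemsS|≡k ,
  subst (λ b → LeExp (k ^ (b * k ^ 3)) (4 * N)) (sym samples∸good≡bad)
        (LeExp-monoʳ {k ^ (bad * k ^ 3)} bad*k³*k≤4N (LeExp-^-* k (bad * k ^ 3)))
  where
  open Scheme {d2 = d2} S F H
  open Counting {d2 = d2} {c = c} S F H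
  open ≤-Reasoning
  N bad : ℕ
  N = nF * nH ^ d2
  bad = count (not ∘ good) samples
  |elemsS|≡k : length elemsS ≡ k
  |elemsS|≡k = trans (length-elements S) ∣S∣≡k
  bad*k³*k≤4N : bad * k ^ 3 * k ≤ 4 * N
  bad*k³*k≤4N = begin
    bad * k ^ 3 * k      ≡⟨ xy∙z≈x∙zy bad (k ^ 3) k ⟩
    bad * k ^ 4          ≤⟨ bad-samples*k⁴≤ (parameters 2≤k κ-ceil d-min d2-ceil c-ceil) |elemsS|≡k F-indep H-univ ⟩
    3 * N                ≤⟨ *-monoˡ-≤ N (n≤1+n 3) ⟩
    4 * N                ∎
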